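{- Let $r\geqslant 2$ be an integer and $n\geqslant 1$. Define numbers $\alpha^+_{n,k;r},\alpha^-_{n,k;r}$ by $\alpha^+_{1,0;r}=1$, $\alpha^-_{1,0;r}=r-2$, $\alpha^+_{1,k;r}=\alpha^-_{1,k;r}=0$ for $k\neq0$, and $$\alpha^+_{n+1,k;r}=(1+rk)\alpha^+_{n,k;r}+2r(n-2k+2)\alpha^+_{n,k-1;r}+2\alpha^-_{n,k-1;r},$$ $$\alpha^-_{n+1,k;r}=(r-2)\alpha^+_{n,k;r}+(r-1+rk)\alpha^-_{n,k;r}+2r(n-2k+1)\alpha^-_{n,k-1;r}$$ (with terms of negative index equal to $0$). Then the $r$-colored Eulerian polynomial $A_{n,r}(x)$ is bi-$\gamma$-positive; more precisely, $$A_{n,r}(x)=\sum_{k=0}^{\lfloor n/2\rfloor}\alpha^+_{n,k;r}x^k(1+x)^{n-2k}+x\sum_{k=0}^{\lfloor (n-1)/2\rfloor}\alpha^-_{n,k;r}x^k(1+x)^{n-1-2k}.$$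
   Context: An $r$-colored permutation of order $n$ is $\pi^c=\pi_1^{c_1}\cdots\pi_n^{c_n}$ with $\pi=\pi_1\cdots\pi_n\in\mathcal{S}_n$ and colors $c_i\in\{0,1,\dots,r-1\}$; $\mathbb{Z}_r\wr\mathcal{S}_n$ is the set of these. Using the total order $1<_f1^{[1]}<_f\cdots<_f1^{[r-1]}<_f2<_f2^{[1]}<_f\cdots<_fn^{[r-1]}$ on colored letters ($i^{[c]}$ = letter $i$ with color $c$), the index $i$ is an excedance of $\pi^c$ if $i<_f\pi_i^{c_i}$ (i.e. $\pi_i>i$, or $\pi_i=i$ and $c_i>0$); $\mathrm{exc}(\pi^c)$ is their number, and $A_{n,r}(x)=\sum_{\pi^c\in\mathbb{Z}_r\wr\mathcal{S}_n}x^{\mathrm{exc}(\pi^c)}$. Bi-$\gamma$-positive means an expansion of the displayed form with all coefficients nonnegative. -}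

module Defs where

open import Data.Bool using (Bool; true; false; not; _∧_; _∨_)
open import Data.Nat as ℕ using (ℕ; zero; suc; _∸_; _≡ᵇ_; _<ᵇ_; ⌊_/2⌋)
open import Data.Fin using (Fin; toℕ; _≟_)
open import Data.Vec using (Vec; []; _∷_; lookup; toList)
open import Data.List using (List; []; _∷_; [_]; map; concatMap; allFin; filterᵇ; length; foldr)
open import Data.Bool.ListAction using (any)
open import Data.Product using (_×_; _,_)
open import Data.Integer using (ℤ; +_; _+_; _*_; _-_; _^_)
open import Relation.Nullary.Decidable using (⌊_⌋)

allVecs : ∀ k m → List (Vec (Fin k) m)
allVecs k zero = [ [] ]
allVecs k (suc m) = concatMap (λ a → map (a ∷_) (allVecs k m)) (allFin k)

distinct : ∀ {n m} → Vec (Fin n) m → Bool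
distinct [] = true
distinct (a ∷ v) = not (any (λ b → ⌊ a ≟ b ⌋) (toList v)) ∧ distinct v

-- The symmetric group S_n: permutations of {0,…,n-1} in one-line notation
-- (the paper's letter i+1 is the Fin element i), each listed exactly once.
perms : ∀ n → List (Vec (Fin n) n)
perms n = filterᵇ distinct (allVecs n n)

-- Z_r ≀ S_n: pairs (π , c) with π ∈ S_n and colour vector c ∈ {0,…,r-1}^n,
-- each listed exactly once.
coloredPerms : ∀ r n → List (Vec (Fin n) n × Vec (Fin r) n)
coloredPerms r n = concatMap (λ π → map (λ c → (π , c)) (allVecs r n)) (perms n)

-- i is an excedance of π^c iff i <_f π_i^{c_i}, i.e. π_i > i, or π_i = i and c_i > 0.
isExc : ∀ {r n} → Vec (Fin n) n → Vec (Fin r) n → Fin n → Bool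
isExc π c i = (toℕ i <ᵇ toℕ (lookup π i))
            ∨ (⌊ lookup π i ≟ i ⌋ ∧ not (toℕ (lookup c i) ≡ᵇ 0))

exc : ∀ {r n} → Vec (Fin n) n × Vec (Fin r) n → ℕ
exc {n = n} (π , c) = length (filterᵇ (isExc π c) (allFin n))

sumℤ : List ℤ → ℤ
sumℤ = foldr _+_ (+ 0)

A : ℕ → ℕ → ℤ → ℤ
A n r x = sumℤ (map (λ w → x ^ exc w) (coloredPerms r n))

Σ≤ : ℕ → (ℕ → ℤ) → ℤ
Σ≤ zero f = f 0
Σ≤ (suc m) f = Σ≤ m f + f (suc m)

-- α⁺ r n k = α^+_{n,k;r},  α⁻ r n k = α^-_{n,k;r}  (n ≥ 1; value 0 at n = 0, unused).
-- Computed in ℤ, literally following the recursion; α_{n,-1} = 0.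
α⁺ α⁻ : ℕ → ℕ → ℕ → ℤ
α⁺ r zero k = + 0
α⁺ r (suc zero) zero = + 1
α⁺ r (suc zero) (suc k) = + 0
α⁺ r (suc (suc n)) zero =
  (+ 1 + + r * + 0) * α⁺ r (suc n) zero
α⁺ r (suc (suc n)) (suc k) =
  (+ 1 + + r * + suc k) * α⁺ r (suc n) (suc k)
  + + 2 * + r * (+ suc n - + 2 * + suc k + + 2) * α⁺ r (suc n) k
  + + 2 * α⁻ r (suc n) k
α⁻ r zero k = + 0
α⁻ r (suc zero) zero = + r - + 2
α⁻ r (suc zero) (suc k) = + 0
α⁻ r (suc (suc n)) zero =
  (+ r - + 2) * α⁺ r (suc n) zero
  + (+ r - + 1 + + r * + 0) * α⁻ r (suc n) zero
α⁻ r (suc (suc n)) (suc k) =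
  (+ r - + 2) * α⁺ r (suc n) (suc k)
  + (+ r - + 1 + + r * + suc k) * α⁻ r (suc n) (suc k)
  + + 2 * + r * (+ suc n - + 2 * + suc k + + 1) * α⁻ r (suc n) k

biGamma : ℕ → ℕ → ℤ → ℤ
biGamma r n x =
  Σ≤ ⌊ n /2⌋ (λ k → α⁺ r n k * x ^ k * (+ 1 + x) ^ (n ∸ 2 ℕ.* k))
  + x * Σ≤ ⌊ (n ∸ 1) /2⌋ (λ k → α⁻ r n k * x ^ k * (+ 1 + x) ^ (n ∸ 1 ∸ 2 ℕ.* k))

-- Polynomials are handled through the functionals they define on sequences f : ℕ → ℤ:
-- A_{n,r} is f ↦ Σ_w f (exc w), and x^k (1 + x)^m is binomialSum m k.  Deleting the smallest
-- letter of a colored permutation of order n + 1 (either a fixed first letter, together with its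
-- colour, or a letter whose place is taken by the first letter) yields the recurrence
-- excSum (n + 1) f = excSum n (excStep n f).  Applying excStep to the γ-basis elements of order n
-- and re-expanding in the basis of order n + 1 reproduces exactly the recursion defining α⁺ and
-- α⁻, so the bi-γ expansion propagates by induction on n; f = x ^_ gives the polynomial identity.
-- The coefficients are nonnegative since the only factors that can be negative, n - 2k + 2 and
-- n - 2k + 1, multiply coefficients α⁺ r n (k - 1) and α⁻ r n (k - 1) that then vanish.
module Submission where

open import Defs
open import Data.Bool using (Bool; true; false; T; not; _∧_; _∨_; if_then_else_)
open import Data.Bool.Properties using (T-≡; T-∧; ∧-zeroʳ; ∧-identityʳ)
open import Data.Bool.ListAction using (any)
open import Data.Nat as ℕ using (ℕ; zero; suc; _≤_; _∸_; _<ᵇ_; _≡ᵇ_; z≤n; s≤s; ⌊_/2⌋)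
import Data.Nat.Properties as ℕₚ
open import Data.Fin as Fin using (Fin; toℕ)
import Data.Fin.Properties as Finₚ
open import Data.Vec as Vec using (Vec; []; _∷_; lookup; toList; _[_]≔_)
import Data.Vec.Properties as Vecₚ
open import Data.List
  using (List; []; _∷_; map; concatMap; allFin; filterᵇ; length; _++_; tabulate; cartesianProduct)
open import Data.Maybe using (Maybe; just; nothing; fromMaybe)
import Data.Maybe as Maybe
open import Data.Product using (_×_; _,_; proj₁; proj₂)
import Data.Product.Properties as Productₚ
open import Data.Integer using (ℤ; +_; ∣_∣; _+_; _*_; _-_; _^_; +≤+) renaming (_≤_ to _≤ℤ_)
import Data.Integer.Properties as ℤₚ
open import Data.Integer.Tactic.RingSolver using (solve-∀)
open import Data.Empty using (⊥-elim)
open import Data.Sum using (inj₁; inj₂)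
open import Function using (_∘_; id)
open import Function.Bundles using (Equivalence)
open import Function.Definitions using (Injective)
open import Relation.Nullary using (Dec; yes; no; ¬_; does)
open import Relation.Nullary.Decidable using (⌊_⌋)
open import Relation.Binary using (DecidableEquality; tri<; tri≈; tri>)
open import Relation.Binary.PropositionalEquality

private variable
  P Q R X Y : Set

-- Sums over lists

∑ : List X → (X → ℤ) → ℤ
∑ xs F = sumℤ (map F xs)

∑-cong : (xs : List X) {F G : X → ℤ} → (∀ x → F x ≡ G x) → ∑ xs F ≡ ∑ xs G
∑-cong []       F≡G = refl
∑-cong (x ∷ xs) F≡G = cong₂ _+_ (F≡G x) (∑-cong xs F≡G)

∑-zero : (xs : List X) → ∑ xs (λ _ → + 0) ≡ + 0
∑-zero []       = refl
∑-zero (x ∷ xs) = trans (ℤₚ.+-identityˡ _) (∑-zero xs)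

∑-++ : (xs ys : List X) (F : X → ℤ) → ∑ (xs ++ ys) F ≡ ∑ xs F + ∑ ys F
∑-++ []       ys F = sym (ℤₚ.+-identityˡ _)
∑-++ (x ∷ xs) ys F = trans (cong (_+_ (F x)) (∑-++ xs ys F)) (sym (ℤₚ.+-assoc (F x) _ _))

∑-+ : (xs : List X) (F G : X → ℤ) → ∑ xs (λ x → F x + G x) ≡ ∑ xs F + ∑ xs G
∑-+ []       F G = refl
∑-+ (x ∷ xs) F G = trans (cong (_+_ (F x + G x)) (∑-+ xs F G)) (interchange (F x) (G x) _ _)
  where
  interchange : ∀ a b c d → a + b + (c + d) ≡ a + c + (b + d)
  interchange = solve-∀

∑-*ˡ : (xs : List X) (c : ℤ) (F : X → ℤ) → ∑ xs (λ x → c * F x) ≡ c * ∑ xs F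
∑-*ˡ []       c F = sym (ℤₚ.*-zeroʳ c)
∑-*ˡ (x ∷ xs) c F = trans (cong (_+_ (c * F x)) (∑-*ˡ xs c F)) (sym (ℤₚ.*-distribˡ-+ c (F x) _))

∑-map : (g : X → Y) (xs : List X) (F : Y → ℤ) → ∑ (map g xs) F ≡ ∑ xs (F ∘ g)
∑-map g []       F = refl
∑-map g (x ∷ xs) F = cong (_+_ (F (g x))) (∑-map g xs F)

∑-concatMap : (g : X → List Y) (xs : List X) (F : Y → ℤ) →
              ∑ (concatMap g xs) F ≡ ∑ xs (λ x → ∑ (g x) F)
∑-concatMap g []       F = refl
∑-concatMap g (x ∷ xs) F =
  trans (∑-++ (g x) (concatMap g xs) F) (cong (_+_ (∑ (g x) F)) (∑-concatMap g xs F))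

∑-cartesianProduct : (xs : List X) (ys : List Y) (F : X × Y → ℤ) →
                     ∑ (cartesianProduct xs ys) F ≡ ∑ xs (λ x → ∑ ys (λ y → F (x , y)))
∑-cartesianProduct []       ys F = refl
∑-cartesianProduct (x ∷ xs) ys F =
  trans (∑-++ (map (x ,_) ys) _ F)
        (cong₂ _+_ (∑-map (x ,_) ys F) (∑-cartesianProduct xs ys F))

∑-cartesianProduct-*ˡ : (xs : List X) (ys : List Y) (c : X → ℤ) (G : X → Y → ℤ) →
  ∑ (cartesianProduct xs ys) (λ z → c (proj₁ z) * G (proj₁ z) (proj₂ z)) ≡ ∑ xs (λ x → c x * ∑ ys (G x))
∑-cartesianProduct-*ˡ xs ys c G =
  trans (∑-cartesianProduct xs ys _) (∑-cong xs (λ x → ∑-*ˡ ys (c x) (G x)))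

∑-comm : (xs : List X) (ys : List Y) (F : X → Y → ℤ) →
         ∑ xs (λ x → ∑ ys (F x)) ≡ ∑ ys (λ y → ∑ xs (λ x → F x y))
∑-comm []       ys F = sym (∑-zero ys)
∑-comm (x ∷ xs) ys F =
  trans (cong (_+_ (∑ ys (F x))) (∑-comm xs ys F)) (sym (∑-+ ys (F x) _))

∑-allFin-suc : (n : ℕ) (F : Fin (suc n) → ℤ) →
               ∑ (allFin (suc n)) F ≡ F Fin.zero + ∑ (allFin n) (F ∘ Fin.suc)
∑-allFin-suc n F = cong (_+_ (F Fin.zero)) (∑-tabulate n Fin.suc F)
  where
  ∑-tabulate : ∀ n (g : Fin n → X) (F : X → ℤ) → ∑ (tabulate g) F ≡ ∑ (allFin n) (F ∘ g)
  ∑-tabulate zero    g F = refl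
  ∑-tabulate (suc n) g F = cong (_+_ (F (g Fin.zero)))
    (trans (∑-tabulate n (g ∘ Fin.suc) F) (sym (∑-tabulate n Fin.suc (F ∘ g))))

∑-allFin-const : (n : ℕ) (c : ℤ) → ∑ (allFin n) (λ _ → c) ≡ + n * c
∑-allFin-const zero    c = sym (ℤₚ.*-zeroˡ c)
∑-allFin-const (suc n) c =
  trans (∑-allFin-suc n (λ _ → c)) (trans (cong (_+_ c) (∑-allFin-const n c)) (lemma c (+ n)))
  where
  lemma : ∀ c n → c + n * c ≡ (+ 1 + n) * c
  lemma = solve-∀

𝟙 : Bool → ℤ
𝟙 true  = + 1
𝟙 false = + 0

∑-filterᵇ : (p : X → Bool) (xs : List X) (F : X → ℤ) →
            ∑ (filterᵇ p xs) F ≡ ∑ xs (λ x → 𝟙 (p x) * F x)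
∑-filterᵇ p []       F = refl
∑-filterᵇ p (x ∷ xs) F with p x
... | true  = cong₂ _+_ (sym (ℤₚ.*-identityˡ (F x))) (∑-filterᵇ p xs F)
... | false = trans (∑-filterᵇ p xs F) (sym (ℤₚ.+-identityˡ _))

𝟙-yes : (a? : Dec P) → P → 𝟙 (does a?) ≡ + 1
𝟙-yes (yes _) _ = refl
𝟙-yes (no ¬a) a = ⊥-elim (¬a a)

𝟙-no : (a? : Dec P) → ¬ P → 𝟙 (does a?) ≡ + 0
𝟙-no (yes a) ¬a = ⊥-elim (¬a a)
𝟙-no (no _)  _  = refl

𝟙-cong : (a? : Dec P) (b? : Dec Q) → (P → Q) → (Q → P) → 𝟙 (does a?) ≡ 𝟙 (does b?)
𝟙-cong (yes a) b? P→Q Q→P = sym (𝟙-yes b? (P→Q a))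
𝟙-cong (no ¬a) b? P→Q Q→P = sym (𝟙-no b? (¬a ∘ Q→P))

𝟙-× : (c? : Dec R) (a? : Dec P) (b? : Dec Q) → (R → P × Q) → (P → Q → R) →
      𝟙 (does c?) ≡ 𝟙 (does a?) * 𝟙 (does b?)
𝟙-× c? (yes a) (yes b) R→P×Q P→Q→R = 𝟙-yes c? (P→Q→R a b)
𝟙-× c? (yes a) (no ¬b) R→P×Q P→Q→R = 𝟙-no c? (¬b ∘ proj₂ ∘ R→P×Q)
𝟙-× c? (no ¬a) b?      R→P×Q P→Q→R = 𝟙-no c? (¬a ∘ proj₁ ∘ R→P×Q)

record Enumerates {X : Set} (_≟_ : DecidableEquality X) (xs : List X) : Set where
  field once : ∀ y → ∑ xs (λ x → 𝟙 (does (x ≟ y))) ≡ + 1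

open Enumerates

∑-delta : {_≟_ : DecidableEquality X} {xs : List X} → Enumerates _≟_ xs →
          ∀ y (G : X → ℤ) → ∑ xs (λ x → 𝟙 (does (x ≟ y)) * G x) ≡ G y
∑-delta {_≟_ = _≟_} {xs} enum y G = begin
  ∑ xs (λ x → 𝟙 (does (x ≟ y)) * G x)  ≡⟨ ∑-cong xs pointwise ⟩
  ∑ xs (λ x → G y * 𝟙 (does (x ≟ y)))  ≡⟨ ∑-*ˡ xs (G y) _ ⟩
  G y * ∑ xs (λ x → 𝟙 (does (x ≟ y)))  ≡⟨ cong (G y *_) (once enum y) ⟩
  G y * + 1                             ≡⟨ ℤₚ.*-identityʳ (G y) ⟩
  G y                                   ∎
  where
  open ≡-Reasoning
  pointwise : ∀ x → 𝟙 (does (x ≟ y)) * G x ≡ G y * 𝟙 (does (x ≟ y))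
  pointwise x with x ≟ y
  ... | yes refl = ℤₚ.*-comm (+ 1) (G x)
  ... | no _     = trans (ℤₚ.*-zeroˡ (G x)) (sym (ℤₚ.*-zeroʳ (G y)))

allFin-enumerates : ∀ n → Enumerates Fin._≟_ (allFin n)
once (allFin-enumerates (suc n)) Fin.zero =
  trans (∑-allFin-suc n (λ j → 𝟙 (does (j Fin.≟ Fin.zero))))
        (cong (_+_ (+ 1)) (trans (∑-cong (allFin n) (λ j → 𝟙-no (Fin.suc j Fin.≟ Fin.zero) λ ()))
                                 (∑-zero (allFin n))))
once (allFin-enumerates (suc n)) (Fin.suc i) =
  trans (∑-allFin-suc n (λ j → 𝟙 (does (j Fin.≟ Fin.suc i))))
        (trans (ℤₚ.+-identityˡ _)
               (trans (∑-cong (allFin n) (λ j → 𝟙-cong (Fin.suc j Fin.≟ Fin.suc i) (j Fin.≟ i)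
                                                        Finₚ.suc-injective (cong Fin.suc)))
                      (once (allFin-enumerates n) i)))

cartesianProduct-enumerates :
  {_≟X_ : DecidableEquality X} {_≟Y_ : DecidableEquality Y} {xs : List X} {ys : List Y} →
  Enumerates _≟X_ xs → Enumerates _≟Y_ ys →
  Enumerates (Productₚ.≡-dec _≟X_ _≟Y_) (cartesianProduct xs ys)
once (cartesianProduct-enumerates {X = X} {Y = Y} {_≟X_} {_≟Y_} {xs} {ys} enumX enumY) (x₀ , y₀) = begin
  ∑ (cartesianProduct xs ys) (λ z → 𝟙 (does (z ≟ (x₀ , y₀))))
    ≡⟨ ∑-cartesianProduct xs ys _ ⟩
  ∑ xs (λ x → ∑ ys (λ y → 𝟙 (does ((x , y) ≟ (x₀ , y₀)))))
    ≡⟨ ∑-cong xs (λ x → ∑-cong ys (λ y →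
         𝟙-× ((x , y) ≟ (x₀ , y₀)) (x ≟X x₀) (y ≟Y y₀) Productₚ.,-injective (cong₂ _,_))) ⟩
  ∑ xs (λ x → ∑ ys (λ y → 𝟙 (does (x ≟X x₀)) * 𝟙 (does (y ≟Y y₀))))
    ≡⟨ ∑-cong xs (λ x → trans (∑-*ˡ ys (𝟙 (does (x ≟X x₀))) _)
                              (cong (𝟙 (does (x ≟X x₀)) *_) (once enumY y₀))) ⟩
  ∑ xs (λ x → 𝟙 (does (x ≟X x₀)) * + 1)
    ≡⟨ ∑-delta enumX x₀ (λ _ → + 1) ⟩
  + 1 ∎
  where
  open ≡-Reasoning
  _≟_ : DecidableEquality (X × Y)
  _≟_ = Productₚ.≡-dec _≟X_ _≟Y_

∑-allVecs-suc : ∀ k m (H : Vec (Fin k) (suc m) → ℤ) →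
                ∑ (allVecs k (suc m)) H ≡ ∑ (allFin k) (λ a → ∑ (allVecs k m) (λ v → H (a ∷ v)))
∑-allVecs-suc k m H =
  trans (∑-concatMap _ (allFin k) H) (∑-cong (allFin k) (λ a → ∑-map (a ∷_) (allVecs k m) H))

_≟ᵛ_ : ∀ {k m} → DecidableEquality (Vec (Fin k) m)
_≟ᵛ_ = Vecₚ.≡-dec Fin._≟_

allVecs-enumerates : ∀ k m → Enumerates _≟ᵛ_ (allVecs k m)
once (allVecs-enumerates k zero)    []         = refl
once (allVecs-enumerates k (suc m)) (a₀ ∷ v₀) = begin
  ∑ (allVecs k (suc m)) (λ w → 𝟙 (does (w ≟ᵛ (a₀ ∷ v₀))))
    ≡⟨ ∑-allVecs-suc k m _ ⟩
  ∑ (allFin k) (λ a → ∑ (allVecs k m) (λ v → 𝟙 (does ((a ∷ v) ≟ᵛ (a₀ ∷ v₀)))))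
    ≡⟨ ∑-cong (allFin k) (λ a → ∑-cong (allVecs k m) (λ v →
         𝟙-× ((a ∷ v) ≟ᵛ (a₀ ∷ v₀)) (a Fin.≟ a₀) (v ≟ᵛ v₀) Vecₚ.∷-injective (cong₂ _∷_))) ⟩
  ∑ (allFin k) (λ a → ∑ (allVecs k m) (λ v → 𝟙 (does (a Fin.≟ a₀)) * 𝟙 (does (v ≟ᵛ v₀))))
    ≡⟨ ∑-cong (allFin k) (λ a →
         trans (∑-*ˡ (allVecs k m) (𝟙 (does (a Fin.≟ a₀))) _)
               (cong (𝟙 (does (a Fin.≟ a₀)) *_) (once (allVecs-enumerates k m) v₀))) ⟩
  ∑ (allFin k) (λ a → 𝟙 (does (a Fin.≟ a₀)) * + 1)
    ≡⟨ ∑-delta (allFin-enumerates k) a₀ (λ _ → + 1) ⟩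
  + 1 ∎
  where open ≡-Reasoning

record Correspondence (P : X → Bool) (Q : Y → Bool) : Set where
  field
    to      : X → Y
    from    : Y → X
    to-Q    : ∀ x → T (P x) → T (Q (to x))
    from-P  : ∀ y → T (Q y) → T (P (from y))
    from∘to : ∀ x → T (P x) → from (to x) ≡ x
    to∘from : ∀ y → T (Q y) → to (from y) ≡ y

module _ {_≟X_ : DecidableEquality X} {_≟Y_ : DecidableEquality Y}
         {P : X → Bool} {Q : Y → Bool} (φ : Correspondence P Q) where

  open Correspondence φ

  private
    true⇒T : ∀ {b} → b ≡ true → T b
    true⇒T = Equivalence.from T-≡

    T⇒≢false : ∀ {b} → T b → b ≢ false
    T⇒≢false t refl = t

  -- Both sides are the indicator of the graph of φ.
  𝟙-graph : ∀ x y → 𝟙 (P x) * 𝟙 (does (y ≟Y to x)) ≡ 𝟙 (Q y) * 𝟙 (does (x ≟X from y))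
  𝟙-graph x y with P x in Px | Q y in Qy
  ... | false | false = refl
  ... | true  | true  = cong (+ 1 *_) (𝟙-cong (y ≟Y to x) (x ≟X from y)
    (λ y≡ → trans (sym (from∘to x (true⇒T Px))) (cong from (sym y≡)))
    (λ x≡ → trans (sym (to∘from y (true⇒T Qy))) (cong to (sym x≡))))
  ... | true  | false = cong (+ 1 *_) (𝟙-no (y ≟Y to x)
    (λ { refl → T⇒≢false (to-Q x (true⇒T Px)) Qy }))
  ... | false | true  = sym (cong (+ 1 *_) (𝟙-no (x ≟X from y)
    (λ { refl → T⇒≢false (from-P y (true⇒T Qy)) Px })))

  ∑-correspondence : (xs : List X) (ys : List Y) → Enumerates _≟X_ xs → Enumerates _≟Y_ ys →
                     (G : X → ℤ) (F : Y → ℤ) → (∀ x → T (P x) → G x ≡ F (to x)) →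
                     ∑ xs (λ x → 𝟙 (P x) * G x) ≡ ∑ ys (λ y → 𝟙 (Q y) * F y)
  ∑-correspondence xs ys enumX enumY G F G≡F∘to = begin
    ∑ xs (λ x → 𝟙 (P x) * G x)
      ≡⟨ ∑-cong xs expand ⟩
    ∑ xs (λ x → ∑ ys (λ y → 𝟙 (P x) * 𝟙 (does (y ≟Y to x)) * F y))
      ≡⟨ ∑-comm xs ys (λ x y → 𝟙 (P x) * 𝟙 (does (y ≟Y to x)) * F y) ⟩
    ∑ ys (λ y → ∑ xs (λ x → 𝟙 (P x) * 𝟙 (does (y ≟Y to x)) * F y))
      ≡⟨ ∑-cong ys (λ y → ∑-cong xs (λ x → cong (_* F y) (𝟙-graph x y))) ⟩
    ∑ ys (λ y → ∑ xs (λ x → 𝟙 (Q y) * 𝟙 (does (x ≟X from y)) * F y))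
      ≡⟨ ∑-cong ys contract ⟩
    ∑ ys (λ y → 𝟙 (Q y) * F y)
      ∎
    where
    open ≡-Reasoning
    expand : ∀ x → 𝟙 (P x) * G x ≡ ∑ ys (λ y → 𝟙 (P x) * 𝟙 (does (y ≟Y to x)) * F y)
    expand x with P x in Px
    ... | false = sym (∑-zero ys)
    ... | true  = begin
      + 1 * G x
        ≡⟨ cong (+ 1 *_) (G≡F∘to x (true⇒T Px)) ⟩
      + 1 * F (to x)
        ≡⟨ cong (+ 1 *_) (∑-delta enumY (to x) F) ⟨
      + 1 * ∑ ys (λ y → 𝟙 (does (y ≟Y to x)) * F y)
        ≡⟨ ∑-*ˡ ys (+ 1) (λ y → 𝟙 (does (y ≟Y to x)) * F y) ⟨
      ∑ ys (λ y → + 1 * (𝟙 (does (y ≟Y to x)) * F y))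
        ≡⟨ ∑-cong ys (λ y → ℤₚ.*-assoc (+ 1) (𝟙 (does (y ≟Y to x))) (F y)) ⟨
      ∑ ys (λ y → + 1 * 𝟙 (does (y ≟Y to x)) * F y)
        ∎
    contract : ∀ y → ∑ xs (λ x → 𝟙 (Q y) * 𝟙 (does (x ≟X from y)) * F y) ≡ 𝟙 (Q y) * F y
    contract y = begin
      ∑ xs (λ x → 𝟙 (Q y) * 𝟙 (does (x ≟X from y)) * F y)
        ≡⟨ ∑-cong xs (λ x → ℤₚ.*-assoc (𝟙 (Q y)) (𝟙 (does (x ≟X from y))) (F y)) ⟩
      ∑ xs (λ x → 𝟙 (Q y) * (𝟙 (does (x ≟X from y)) * F y))
        ≡⟨ ∑-*ˡ xs (𝟙 (Q y)) (λ x → 𝟙 (does (x ≟X from y)) * F y) ⟩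
      𝟙 (Q y) * ∑ xs (λ x → 𝟙 (does (x ≟X from y)) * F y)
        ≡⟨ cong (𝟙 (Q y) *_) (∑-delta enumX (from y) (λ _ → F y)) ⟩
      𝟙 (Q y) * F y
        ∎

-- Permutations, counting and excedances

lookup-ext : ∀ {A : Set} {n} (u v : Vec A n) → (∀ i → lookup u i ≡ lookup v i) → u ≡ v
lookup-ext u v eq = trans (sym (Vecₚ.tabulate∘lookup u))
                          (trans (Vecₚ.tabulate-cong eq) (Vecₚ.tabulate∘lookup v))

Injectiveᵛ : ∀ {k m} → Vec (Fin k) m → Set
Injectiveᵛ v = Injective _≡_ _≡_ (lookup v)

module _ {k m} {a : Fin k} {v : Vec (Fin k) m} where

  Injectiveᵛ-∷ : (∀ i → lookup v i ≢ a) → Injectiveᵛ v → Injectiveᵛ (a ∷ v)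
  Injectiveᵛ-∷ a∉v inj {Fin.zero}  {Fin.zero}  eq = refl
  Injectiveᵛ-∷ a∉v inj {Fin.zero}  {Fin.suc j} eq = ⊥-elim (a∉v j (sym eq))
  Injectiveᵛ-∷ a∉v inj {Fin.suc i} {Fin.zero}  eq = ⊥-elim (a∉v i eq)
  Injectiveᵛ-∷ a∉v inj {Fin.suc i} {Fin.suc j} eq = cong Fin.suc (inj eq)

  Injectiveᵛ-head : Injectiveᵛ (a ∷ v) → ∀ i → lookup v i ≢ a
  Injectiveᵛ-head inj i eq with () ← inj {Fin.zero} {Fin.suc i} (sym eq)

  Injectiveᵛ-tail : Injectiveᵛ (a ∷ v) → Injectiveᵛ v
  Injectiveᵛ-tail inj eq = Finₚ.suc-injective (inj eq)

module _ {k} (a : Fin k) where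

  notAny⇒lookup≢ : ∀ {m} (v : Vec (Fin k) m) → T (not (any (λ b → ⌊ a Fin.≟ b ⌋) (toList v))) →
                   ∀ i → lookup v i ≢ a
  notAny⇒lookup≢ (b ∷ v) fresh i eq with a Fin.≟ b
  notAny⇒lookup≢ (b ∷ v) ()    i       eq | yes _
  notAny⇒lookup≢ (b ∷ v) fresh Fin.zero    eq | no a≢b = a≢b (sym eq)
  notAny⇒lookup≢ (b ∷ v) fresh (Fin.suc i) eq | no a≢b = notAny⇒lookup≢ v fresh i eq

  lookup≢⇒notAny : ∀ {m} (v : Vec (Fin k) m) → (∀ i → lookup v i ≢ a) →
                   T (not (any (λ b → ⌊ a Fin.≟ b ⌋) (toList v)))
  lookup≢⇒notAny []      a∉v = _
  lookup≢⇒notAny (b ∷ v) a∉v with a Fin.≟ b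
  ... | yes a≡b = a∉v Fin.zero (sym a≡b)
  ... | no  _   = lookup≢⇒notAny v (a∉v ∘ Fin.suc)

distinct⇒injective : ∀ {k m} (v : Vec (Fin k) m) → T (distinct v) → Injectiveᵛ v
distinct⇒injective []      _  {()}
distinct⇒injective (a ∷ v) d with fresh , d′ ← Equivalence.to T-∧ d =
  Injectiveᵛ-∷ (notAny⇒lookup≢ a v fresh) (distinct⇒injective v d′)

injective⇒distinct : ∀ {k m} (v : Vec (Fin k) m) → Injectiveᵛ v → T (distinct v)
injective⇒distinct []      _   = _
injective⇒distinct (a ∷ v) inj = Equivalence.from T-∧
  (lookup≢⇒notAny a v (Injectiveᵛ-head inj) , injective⇒distinct v (Injectiveᵛ-tail inj))

bit : Bool → ℕ
bit true  = 1
bit false = 0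

count : ∀ n → (Fin n → Bool) → ℕ
count zero    b = 0
count (suc n) b = bit (b Fin.zero) ℕ.+ count n (b ∘ Fin.suc)

length-filterᵇ-tabulate : ∀ n (g : Fin n → X) (b : X → Bool) →
                          length (filterᵇ b (tabulate g)) ≡ count n (b ∘ g)
length-filterᵇ-tabulate zero    g b = refl
length-filterᵇ-tabulate (suc n) g b with b (g Fin.zero)
... | true  = cong suc (length-filterᵇ-tabulate n (g ∘ Fin.suc) b)
... | false = length-filterᵇ-tabulate n (g ∘ Fin.suc) b

count-cong : ∀ n {b b′ : Fin n → Bool} → (∀ i → b i ≡ b′ i) → count n b ≡ count n b′
count-cong zero    eq = refl
count-cong (suc n) eq = cong₂ (λ x y → bit x ℕ.+ y) (eq Fin.zero) (count-cong n (eq ∘ Fin.suc))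

⌊suc≟suc⌋ : ∀ {n} (i j : Fin n) → ⌊ Fin.suc i Fin.≟ Fin.suc j ⌋ ≡ ⌊ i Fin.≟ j ⌋
⌊suc≟suc⌋ i j with i Fin.≟ j | Fin.suc i Fin.≟ Fin.suc j
... | yes _   | yes _     = refl
... | no  _   | no  _     = refl
... | yes i≡j | no  si≢sj = ⊥-elim (si≢sj (cong Fin.suc i≡j))
... | no  i≢j | yes si≡sj = ⊥-elim (i≢j (Finₚ.suc-injective si≡sj))

count-remove : ∀ n (b : Fin n → Bool) (p : Fin n) →
               count n b ≡ count n (λ i → b i ∧ not ⌊ i Fin.≟ p ⌋) ℕ.+ bit (b p)
count-remove (suc n) b Fin.zero =
  trans (ℕₚ.+-comm (bit (b Fin.zero)) _)
        (cong₂ (λ x y → (bit x ℕ.+ y) ℕ.+ bit (b Fin.zero))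
               (sym (∧-zeroʳ (b Fin.zero)))
               (count-cong n (λ i → sym (∧-identityʳ (b (Fin.suc i))))))
count-remove (suc n) b (Fin.suc p) =
  trans (cong (bit (b Fin.zero) ℕ.+_) (count-remove n (b ∘ Fin.suc) p))
        (trans (sym (ℕₚ.+-assoc (bit (b Fin.zero)) _ _))
               (cong₂ (λ x y → (bit x ℕ.+ y) ℕ.+ bit (b (Fin.suc p)))
                      (sym (∧-identityʳ (b Fin.zero)))
                      (count-cong n (λ i → cong (λ z → b (Fin.suc i) ∧ not z) (sym (⌊suc≟suc⌋ i p))))))

∑-allFin-if : ∀ n (b : Fin n → Bool) (u v : ℤ) →
  ∑ (allFin n) (λ p → if b p then u else v) ≡ + count n b * u + (+ n - + count n b) * v
∑-allFin-if zero    b u v = refl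
∑-allFin-if (suc n) b u v =
  trans (∑-allFin-suc n (λ p → if b p then u else v))
        (trans (cong (_+_ (if b Fin.zero then u else v)) (∑-allFin-if n (b ∘ Fin.suc) u v))
               (step (b Fin.zero)))
  where
  k : ℕ
  k = count n (b ∘ Fin.suc)
  step : ∀ b₀ → (if b₀ then u else v) + (+ k * u + (+ n - + k) * v)
              ≡ + (bit b₀ ℕ.+ k) * u + (+ suc n - + (bit b₀ ℕ.+ k)) * v
  step true  = trans (lemma u v (+ k) (+ n))
                     (cong₂ (λ i j → i * u + (j - i) * v) (sym (ℤₚ.pos-+ 1 k)) (sym (ℤₚ.pos-+ 1 n)))
    where
    lemma : ∀ u v k n → u + (k * u + (n - k) * v) ≡ (+ 1 + k) * u + ((+ 1 + n) - (+ 1 + k)) * v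
    lemma = solve-∀
  step false = trans (lemma u v (+ k) (+ n)) (cong (λ j → + k * u + (j - + k) * v) (sym (ℤₚ.pos-+ 1 n)))
    where
    lemma : ∀ u v k n → v + (k * u + (n - k) * v) ≡ k * u + ((+ 1 + n) - k) * v
    lemma = solve-∀

isExcAt : ∀ {n r} → Fin n → Fin n → Fin r → Bool
isExcAt i y col = (toℕ i <ᵇ toℕ y) ∨ (⌊ y Fin.≟ i ⌋ ∧ not (toℕ col ≡ᵇ 0))

exc≡count : ∀ {r n} (π : Vec (Fin n) n) (c : Vec (Fin r) n) →
            exc (π , c) ≡ count n (λ i → isExcAt i (lookup π i) (lookup c i))
exc≡count {n = n} π c = length-filterᵇ-tabulate n id (isExc π c)

isExcAt-suc : ∀ {n r} (i y : Fin n) (col : Fin r) →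
              isExcAt {suc n} (Fin.suc i) (Fin.suc y) col ≡ isExcAt {n} i y col
isExcAt-suc i y col = cong (λ z → (toℕ i <ᵇ toℕ y) ∨ (z ∧ not (toℕ col ≡ᵇ 0))) (⌊suc≟suc⌋ y i)

-- Deleting the smallest letter

1+n≢0 : ∀ {n} {i : Fin n} → Fin.suc i ≢ Fin.zero
1+n≢0 ()

predOr : ∀ {n} → Fin n → Fin (suc n) → Fin n
predOr d Fin.zero    = d
predOr d (Fin.suc i) = i

suc-predOr : ∀ {n} (d : Fin n) {y : Fin (suc n)} → y ≢ Fin.zero → Fin.suc (predOr d y) ≡ y
suc-predOr d {Fin.zero}  y≢0 = ⊥-elim (y≢0 refl)
suc-predOr d {Fin.suc y} y≢0 = refl

-- A zero entry, which never occurs where predᵛ is used, is sent to zero.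
predᵛ : ∀ {n} → Vec (Fin (suc n)) n → Vec (Fin n) n
predᵛ {zero}  []      = []
predᵛ {suc n} v       = Vec.map (predOr Fin.zero) v

suc-lookup-predᵛ : ∀ {n} (v : Vec (Fin (suc n)) n) (i : Fin n) → lookup v i ≢ Fin.zero →
                   Fin.suc (lookup (predᵛ v) i) ≡ lookup v i
suc-lookup-predᵛ {suc n} v i v≢0 =
  trans (cong Fin.suc (Vecₚ.lookup-map i (predOr Fin.zero) v)) (suc-predOr Fin.zero v≢0)

predᵛ-map-suc : ∀ {n} (π : Vec (Fin n) n) → predᵛ (Vec.map Fin.suc π) ≡ π
predᵛ-map-suc {zero}  [] = refl
predᵛ-map-suc {suc n} π  = trans (sym (Vecₚ.map-∘ (predOr Fin.zero) Fin.suc π)) (Vecₚ.map-id π)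

Injectiveᵛ-map-suc : ∀ {k m} (π : Vec (Fin k) m) → Injectiveᵛ π → Injectiveᵛ (Vec.map Fin.suc π)
Injectiveᵛ-map-suc π inj {i} {j} eq = inj (Finₚ.suc-injective
  (trans (sym (Vecₚ.lookup-map i Fin.suc π)) (trans eq (Vecₚ.lookup-map j Fin.suc π))))

-- Colored permutations of order n + 1 whose first letter is fixed, with the colour c₀ of that
-- fixed point split off, correspond to colored permutations of order n.
module FixedFirstLetter (r n : ℕ) where

  Source Target : Set
  Source = Vec (Fin (suc n)) n × (Fin r × Vec (Fin r) n)
  Target = Vec (Fin n) n × (Vec (Fin r) n × Fin r)

  isSource : Source → Bool
  isSource (v , _) = distinct (Fin.zero ∷ v)

  isTarget : Target → Bool
  isTarget (π , _) = distinct π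

  nonzero : ∀ (v : Vec (Fin (suc n)) n) → T (distinct (Fin.zero ∷ v)) → ∀ i → lookup v i ≢ Fin.zero
  nonzero v d = Injectiveᵛ-head (distinct⇒injective (Fin.zero ∷ v) d)

  correspondence : Correspondence isSource isTarget
  correspondence = record
    { to      = λ { (v , c₀ , c) → predᵛ v , c , c₀ }
    ; from    = λ { (π , c , t) → Vec.map Fin.suc π , t , c }
    ; to-Q    = λ { (v , _) d → injective⇒distinct (predᵛ v) (λ {i} {j} eq →
                    Finₚ.suc-injective (distinct⇒injective (Fin.zero ∷ v) d
                      (trans (sym (suc-lookup-predᵛ v i (nonzero v d i)))
                             (trans (cong Fin.suc eq) (suc-lookup-predᵛ v j (nonzero v d j)))))) }
    ; from-P  = λ { (π , _) d → injective⇒distinct (Fin.zero ∷ Vec.map Fin.suc π)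
                    (Injectiveᵛ-∷ (λ i eq → Finₚ.0≢1+n (trans (sym eq) (Vecₚ.lookup-map i Fin.suc π)))
                                 (Injectiveᵛ-map-suc π (distinct⇒injective π d))) }
    ; from∘to = λ { (v , c₀ , c) d → cong (_, c₀ , c) (lookup-ext _ v (λ i →
                    trans (Vecₚ.lookup-map i Fin.suc (predᵛ v)) (suc-lookup-predᵛ v i (nonzero v d i)))) }
    ; to∘from = λ { (π , c , t) _ → cong (_, c , t) (predᵛ-map-suc π) }
    }

  sourceExc : Source → ℕ
  sourceExc (v , c₀ , c) = exc (Fin.zero ∷ v , c₀ ∷ c)

  targetExc : Target → ℕ
  targetExc (π , c , t) = bit (isExcAt {suc n} Fin.zero Fin.zero t) ℕ.+ exc (π , c)

  sourceExc≡targetExc : ∀ x → T (isSource x) → sourceExc x ≡ targetExc (Correspondence.to correspondence x)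
  sourceExc≡targetExc (v , c₀ , c) d =
    trans (exc≡count (Fin.zero ∷ v) (c₀ ∷ c))
          (cong (bit (isExcAt {suc n} Fin.zero Fin.zero c₀) ℕ.+_)
                (trans (count-cong n shift) (sym (exc≡count (predᵛ v) c))))
    where
    shift : ∀ i → isExcAt (Fin.suc i) (lookup v i) (lookup c i)
                ≡ isExcAt i (lookup (predᵛ v) i) (lookup c i)
    shift i = trans (cong (λ y → isExcAt (Fin.suc i) y (lookup c i))
                          (sym (suc-lookup-predᵛ v i (nonzero v d i))))
                    (isExcAt-suc i (lookup (predᵛ v) i) (lookup c i))

  sources : List Source
  sources = cartesianProduct (allVecs (suc n) n) (cartesianProduct (allFin r) (allVecs r n))

  targets : List Target
  targets = cartesianProduct (allVecs n n) (cartesianProduct (allVecs r n) (allFin r))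

  ∑-sources≡∑-targets : (f : ℕ → ℤ) → ∑ sources (λ x → 𝟙 (isSource x) * f (sourceExc x))
                                    ≡ ∑ targets (λ y → 𝟙 (isTarget y) * f (targetExc y))
  ∑-sources≡∑-targets f = ∑-correspondence correspondence sources targets
    (cartesianProduct-enumerates (allVecs-enumerates (suc n) n)
      (cartesianProduct-enumerates (allFin-enumerates r) (allVecs-enumerates r n)))
    (cartesianProduct-enumerates (allVecs-enumerates n n)
      (cartesianProduct-enumerates (allVecs-enumerates r n) (allFin-enumerates r)))
    (f ∘ sourceExc) (f ∘ targetExc) (λ x d → cong f (sourceExc≡targetExc x d))

findZero : ∀ {k m} → Vec (Fin (suc k)) m → Maybe (Fin m)
findZero []               = nothing
findZero (Fin.zero  ∷ v)  = just Fin.zero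
findZero (Fin.suc _ ∷ v)  = Maybe.map Fin.suc (findZero v)

findZero-just : ∀ {k m} (v : Vec (Fin (suc k)) m) {j} → findZero v ≡ just j → lookup v j ≡ Fin.zero
findZero-just (Fin.zero  ∷ v) refl = refl
findZero-just (Fin.suc _ ∷ v) eq with findZero v in found
findZero-just (Fin.suc _ ∷ v) refl | just j = findZero-just v found

findZero-nothing : ∀ {k m} (v : Vec (Fin (suc k)) m) → findZero v ≡ nothing →
                   ∀ i → lookup v i ≢ Fin.zero
findZero-nothing (Fin.zero  ∷ v) ()
findZero-nothing (Fin.suc _ ∷ v) eq Fin.zero ()
findZero-nothing (Fin.suc _ ∷ v) eq (Fin.suc i) with findZero v in found
findZero-nothing (Fin.suc _ ∷ v) refl (Fin.suc i) | nothing = findZero-nothing v found i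

zeroIndex : ∀ {k m} → Fin m → Vec (Fin (suc k)) m → Fin m
zeroIndex d v = fromMaybe d (findZero v)

zeroIndex-unique : ∀ {k m} (d : Fin m) (v : Vec (Fin (suc k)) m) (q : Fin m) → lookup v q ≡ Fin.zero →
                   (∀ i → lookup v i ≡ Fin.zero → i ≡ q) → zeroIndex d v ≡ q
zeroIndex-unique d v q vq≡0 unique with findZero v in found
... | just j  = unique j (findZero-just v found)
... | nothing = ⊥-elim (findZero-nothing v found q vq≡0)

-- A permutation a ∷ v of order n + 1 with a ≠ 0 has the letter 0 somewhere in v:
-- otherwise decrementing every letter would inject Fin (n + 1) into Fin n.
lookup-zeroIndex : ∀ {n} (m : Fin n) (v : Vec (Fin (suc n)) n) → Injectiveᵛ (Fin.suc m ∷ v) →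
                   lookup v (zeroIndex m v) ≡ Fin.zero
lookup-zeroIndex m v inj with findZero v in found
... | just j  = findZero-just v found
... | nothing = ⊥-elim (Finₚ.<⇒notInjective (ℕₚ.n<1+n _) decrement-injective)
  where
  w : Vec (Fin (suc _)) (suc _)
  w = Fin.suc m ∷ v
  w≢0 : ∀ i → lookup w i ≢ Fin.zero
  w≢0 Fin.zero    ()
  w≢0 (Fin.suc i) = findZero-nothing v found i
  decrement-injective : Injective _≡_ _≡_ (λ i → predOr m (lookup w i))
  decrement-injective {i} {j} eq =
    inj (trans (sym (suc-predOr m (w≢0 i))) (trans (cong Fin.suc eq) (suc-predOr m (w≢0 j))))

-- Colored permutations of order n + 1 with first letter m + 1 correspond to colored permutations
-- (π , c) of order n together with a colour t and a position p: the letter 0 of the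
-- original sits at position p + 1 with colour t, and π is obtained by moving the first letter into
-- its place and decrementing all letters.
module MovedFirstLetter (r n : ℕ) where

  Source Target : Set
  Source = Fin n × (Vec (Fin (suc n)) n × (Fin r × Vec (Fin r) n))
  Target = Vec (Fin n) n × (Vec (Fin r) n × (Fin r × Fin n))

  isSource : Source → Bool
  isSource (m , v , _) = distinct (Fin.suc m ∷ v)

  isTarget : Target → Bool
  isTarget (π , _) = distinct π

  remove : Source → Target
  remove (m , v , c₀ , c) = let p = zeroIndex m v in
    Vec.map (predOr m) (v [ p ]≔ Fin.suc m) , c [ p ]≔ c₀ , lookup c p , p

  insert : Target → Source
  insert (π , c , t , p) = lookup π p , (Vec.map Fin.suc π) [ p ]≔ Fin.zero , lookup c p , c [ p ]≔ t

  module Removal (m : Fin n) (v : Vec (Fin (suc n)) n) (inj : Injectiveᵛ (Fin.suc m ∷ v)) where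

    p : Fin n
    p = zeroIndex m v

    w : Vec (Fin (suc n)) n
    w = v [ p ]≔ Fin.suc m

    π : Vec (Fin n) n
    π = Vec.map (predOr m) w

    vp≡0 : lookup v p ≡ Fin.zero
    vp≡0 = lookup-zeroIndex m v inj

    lookup-w≢p : ∀ {i} → i ≢ p → lookup w i ≡ lookup v i
    lookup-w≢p i≢p = Vecₚ.lookup∘update′ i≢p v (Fin.suc m)

    w≢0 : ∀ i → lookup w i ≢ Fin.zero
    w≢0 i with i Fin.≟ p
    ... | yes refl = λ eq → 1+n≢0 (trans (sym (Vecₚ.lookup∘update i v (Fin.suc m))) eq)
    ... | no  i≢p  = λ eq →
      i≢p (Injectiveᵛ-tail inj (trans (trans (sym (lookup-w≢p i≢p)) eq) (sym vp≡0)))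

    w-injective : Injectiveᵛ w
    w-injective {i} {j} eq with i Fin.≟ p | j Fin.≟ p
    ... | yes refl | yes refl = refl
    ... | yes refl | no  j≢p  = ⊥-elim (Injectiveᵛ-head inj j
          (sym (trans (sym (Vecₚ.lookup∘update i v (Fin.suc m))) (trans eq (lookup-w≢p j≢p)))))
    ... | no  i≢p  | yes refl = ⊥-elim (Injectiveᵛ-head inj i
          (trans (sym (lookup-w≢p i≢p)) (trans eq (Vecₚ.lookup∘update j v (Fin.suc m)))))
    ... | no  i≢p  | no  j≢p  =
      Injectiveᵛ-tail inj (trans (sym (lookup-w≢p i≢p)) (trans eq (lookup-w≢p j≢p)))

    suc-lookup-π : ∀ i → Fin.suc (lookup π i) ≡ lookup w i
    suc-lookup-π i = trans (cong Fin.suc (Vecₚ.lookup-map i (predOr m) w)) (suc-predOr m (w≢0 i))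

    π-injective : Injectiveᵛ π
    π-injective {i} {j} eq = w-injective (trans (sym (suc-lookup-π i)) (trans (cong Fin.suc eq) (suc-lookup-π j)))

    lookup-π-p : lookup π p ≡ m
    lookup-π-p = trans (Vecₚ.lookup-map p (predOr m) w) (cong (predOr m) (Vecₚ.lookup∘update p v (Fin.suc m)))

    suc-lookup-π≢p : ∀ i → i ≢ p → Fin.suc (lookup π i) ≡ lookup v i
    suc-lookup-π≢p i i≢p = trans (suc-lookup-π i) (lookup-w≢p i≢p)

    insert∘remove-v : (Vec.map Fin.suc π) [ p ]≔ Fin.zero ≡ v
    insert∘remove-v = lookup-ext _ v pointwise
      where
      pointwise : ∀ i → lookup ((Vec.map Fin.suc π) [ p ]≔ Fin.zero) i ≡ lookup v i
      pointwise i with i Fin.≟ p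
      ... | yes refl = trans (Vecₚ.lookup∘update i (Vec.map Fin.suc π) Fin.zero) (sym vp≡0)
      ... | no  i≢p  = trans (Vecₚ.lookup∘update′ i≢p (Vec.map Fin.suc π) Fin.zero)
                             (trans (Vecₚ.lookup-map i Fin.suc π) (suc-lookup-π≢p i i≢p))

  module Insertion (π : Vec (Fin n) n) (p : Fin n) (inj : Injectiveᵛ π) where

    m : Fin n
    m = lookup π p

    v : Vec (Fin (suc n)) n
    v = (Vec.map Fin.suc π) [ p ]≔ Fin.zero

    vp≡0 : lookup v p ≡ Fin.zero
    vp≡0 = Vecₚ.lookup∘update p (Vec.map Fin.suc π) Fin.zero

    lookup-v≢p : ∀ i → i ≢ p → lookup v i ≡ Fin.suc (lookup π i)
    lookup-v≢p i i≢p =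
      trans (Vecₚ.lookup∘update′ i≢p (Vec.map Fin.suc π) Fin.zero) (Vecₚ.lookup-map i Fin.suc π)

    zeroIndex-v : zeroIndex m v ≡ p
    zeroIndex-v = zeroIndex-unique m v p vp≡0 only-p
      where
      only-p : ∀ i → lookup v i ≡ Fin.zero → i ≡ p
      only-p i vi≡0 with i Fin.≟ p
      ... | yes i≡p = i≡p
      ... | no  i≢p = ⊥-elim (1+n≢0 (trans (sym (lookup-v≢p i i≢p)) vi≡0))

    v-injective : Injectiveᵛ v
    v-injective {i} {j} eq with i Fin.≟ p | j Fin.≟ p
    ... | yes refl | yes refl = refl
    ... | yes refl | no  j≢p  = ⊥-elim (Finₚ.0≢1+n (trans (sym vp≡0) (trans eq (lookup-v≢p j j≢p))))
    ... | no  i≢p  | yes refl = ⊥-elim (1+n≢0 (trans (sym (lookup-v≢p i i≢p)) (trans eq vp≡0)))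
    ... | no  i≢p  | no  j≢p  =
      inj (Finₚ.suc-injective (trans (sym (lookup-v≢p i i≢p)) (trans eq (lookup-v≢p j j≢p))))

    m∉v : ∀ i → lookup v i ≢ Fin.suc m
    m∉v i eq with i Fin.≟ p
    ... | yes refl = Finₚ.0≢1+n (trans (sym vp≡0) eq)
    ... | no  i≢p  = i≢p (inj (Finₚ.suc-injective (trans (sym (lookup-v≢p i i≢p)) eq)))

    remove∘insert-π : Vec.map (predOr m) (v [ p ]≔ Fin.suc m) ≡ π
    remove∘insert-π = lookup-ext _ π pointwise
      where
      pointwise : ∀ i → lookup (Vec.map (predOr m) (v [ p ]≔ Fin.suc m)) i ≡ lookup π i
      pointwise i with i Fin.≟ p
      ... | yes refl = trans (Vecₚ.lookup-map i (predOr m) (v [ i ]≔ Fin.suc m))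
                             (cong (predOr m) (Vecₚ.lookup∘update i v (Fin.suc m)))
      ... | no  i≢p  = trans (Vecₚ.lookup-map i (predOr m) (v [ p ]≔ Fin.suc m))
                             (cong (predOr m) (trans (Vecₚ.lookup∘update′ i≢p v (Fin.suc m)) (lookup-v≢p i i≢p)))

  insert∘remove : ∀ x → T (isSource x) → insert (remove x) ≡ x
  insert∘remove (m , v , c₀ , c) d =
    cong₂ _,_ lookup-π-p (cong₂ _,_ insert∘remove-v
      (cong₂ _,_ (Vecₚ.lookup∘update p c c₀) (trans (Vecₚ.[]≔-idempotent c p) (Vecₚ.[]≔-lookup c p))))
    where open Removal m v (distinct⇒injective _ d)

  remove∘insert : ∀ y → T (isTarget y) → remove (insert y) ≡ y
  remove∘insert (π , c , t , p) d = at-zeroIndex (zeroIndex m v) zeroIndex-v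
    where
    open Insertion π p (distinct⇒injective π d)
    at-zeroIndex : ∀ q → q ≡ p →
      (Vec.map (predOr m) (v [ q ]≔ Fin.suc m) , (c [ p ]≔ t) [ q ]≔ lookup c p , lookup (c [ p ]≔ t) q , q)
      ≡ (π , c , t , p)
    at-zeroIndex .p refl =
      cong₂ _,_ remove∘insert-π (cong₂ _,_ (trans (Vecₚ.[]≔-idempotent c p) (Vecₚ.[]≔-lookup c p))
                                           (cong (_, p) (Vecₚ.lookup∘update p c t)))

  correspondence : Correspondence isSource isTarget
  correspondence = record
    { to      = remove
    ; from    = insert
    ; to-Q    = λ { (m , v , _) d → let open Removal m v (distinct⇒injective _ d) in
                    injective⇒distinct π π-injective }
    ; from-P  = λ { (π , c , t , p) d → let open Insertion π p (distinct⇒injective π d) in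
                    injective⇒distinct (Fin.suc m ∷ v) (Injectiveᵛ-∷ m∉v v-injective) }
    ; from∘to = insert∘remove
    ; to∘from = remove∘insert
    }

  sourceExc : Source → ℕ
  sourceExc (m , v , c₀ , c) = exc (Fin.suc m ∷ v , c₀ ∷ c)

  -- Position 0 of the original is always an excedance and its letter 0 never is; the other positions
  -- match those of (π , c) except p, whose excedance status is lost.
  targetExc : Target → ℕ
  targetExc (π , c , _ , p) = if isExc π c p then exc (π , c) else suc (exc (π , c))

  sourceExc≡targetExc : ∀ x → T (isSource x) → sourceExc x ≡ targetExc (remove x)
  sourceExc≡targetExc (m , v , c₀ , c) d =
    trans (exc≡count (Fin.suc m ∷ v) (c₀ ∷ c))
          (trans (cong suc (count-cong n shift))
                 (restore (isExc π c′ p) (trans (exc≡count π c′) (count-remove n (isExc π c′) p))))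
    where
    open Removal m v (distinct⇒injective _ d)
    c′ : Vec (Fin r) n
    c′ = c [ p ]≔ c₀
    K : ℕ
    K = count n (λ i → isExc π c′ i ∧ not ⌊ i Fin.≟ p ⌋)
    shift : ∀ i → isExcAt (Fin.suc i) (lookup v i) (lookup c i) ≡ isExc π c′ i ∧ not ⌊ i Fin.≟ p ⌋
    shift i with i Fin.≟ p
    ... | yes refl = trans (cong (λ y → isExcAt (Fin.suc i) y (lookup c i)) vp≡0) (sym (∧-zeroʳ _))
    ... | no  i≢p  = trans (cong₂ (isExcAt (Fin.suc i)) (sym (suc-lookup-π≢p i i≢p))
                                                        (sym (Vecₚ.lookup∘update′ i≢p c c₀)))
                           (trans (isExcAt-suc i (lookup π i) (lookup c′ i)) (sym (∧-identityʳ _)))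
    restore : ∀ b {e} → e ≡ K ℕ.+ bit b → suc K ≡ (if b then e else suc e)
    restore true  refl = ℕₚ.+-comm 1 K
    restore false refl = cong suc (sym (ℕₚ.+-identityʳ K))

  sources : List Source
  sources = cartesianProduct (allFin n) (FixedFirstLetter.sources r n)

  targets : List Target
  targets = cartesianProduct (allVecs n n) (cartesianProduct (allVecs r n) (cartesianProduct (allFin r) (allFin n)))

  ∑-sources≡∑-targets : (f : ℕ → ℤ) → ∑ sources (λ x → 𝟙 (isSource x) * f (sourceExc x))
                                    ≡ ∑ targets (λ y → 𝟙 (isTarget y) * f (targetExc y))
  ∑-sources≡∑-targets f = ∑-correspondence correspondence sources targets
    (cartesianProduct-enumerates (allFin-enumerates n) (cartesianProduct-enumerates (allVecs-enumerates (suc n) n)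
      (cartesianProduct-enumerates (allFin-enumerates r) (allVecs-enumerates r n))))
    (cartesianProduct-enumerates (allVecs-enumerates n n) (cartesianProduct-enumerates (allVecs-enumerates r n)
      (cartesianProduct-enumerates (allFin-enumerates r) (allFin-enumerates n))))
    (f ∘ sourceExc) (f ∘ targetExc) (λ x d → cong f (sourceExc≡targetExc x d))

-- The recurrence for excedance sums

∑-coloredPerms : ∀ r m (H : Vec (Fin m) m × Vec (Fin r) m → ℤ) →
  ∑ (coloredPerms r m) H ≡ ∑ (allVecs m m) (λ π → 𝟙 (distinct π) * ∑ (allVecs r m) (λ c → H (π , c)))
∑-coloredPerms r m H =
  trans (∑-concatMap _ (perms m) H)
        (trans (∑-filterᵇ distinct (allVecs m m) _)
               (∑-cong (allVecs m m) (λ π → cong (𝟙 (distinct π) *_) (∑-map (π ,_) (allVecs r m) H))))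

excSum : ℕ → ℕ → (ℕ → ℤ) → ℤ
excSum r n f = ∑ (coloredPerms r n) (f ∘ exc)

-- A_{n+1,r} arises from A_{n,r} by replacing each x^e with (1 + r e) x^e + (r (n - e) + r - 1) x^(e+1).
excStep : ℕ → ℕ → (ℕ → ℤ) → ℕ → ℤ
excStep r n f e = (+ 1 + + r * + e) * f e + (+ r * (+ n - + e) + + r - + 1) * f (suc e)

module ExcRecurrence (r′ n : ℕ) (f : ℕ → ℤ) where

  r : ℕ
  r = suc r′

  module Fixed = FixedFirstLetter r n
  module Moved = MovedFirstLetter r n

  firstLetterSum : Fin (suc n) → ℤ
  firstLetterSum a = ∑ (allVecs (suc n) n) (λ v →
    𝟙 (distinct (a ∷ v)) * ∑ (allVecs r (suc n)) (λ c → f (exc (a ∷ v , c))))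

  firstLetterSum≡ : ∀ a → firstLetterSum a ≡ ∑ Fixed.sources (λ x →
    𝟙 (distinct (a ∷ proj₁ x)) * f (exc (a ∷ proj₁ x , proj₁ (proj₂ x) ∷ proj₂ (proj₂ x))))
  firstLetterSum≡ a = sym
    (trans (∑-cartesianProduct-*ˡ (allVecs (suc n) n) _ (λ v → 𝟙 (distinct (a ∷ v))) _)
           (∑-cong (allVecs (suc n) n) (λ v → cong (𝟙 (distinct (a ∷ v)) *_)
             (trans (∑-cartesianProduct (allFin r) (allVecs r n) _)
                    (sym (∑-allVecs-suc r n (λ c → f (exc (a ∷ v , c)))))))))

  split : excSum r (suc n) f ≡ ∑ Fixed.sources (λ x → 𝟙 (Fixed.isSource x) * f (Fixed.sourceExc x))
                             + ∑ Moved.sources (λ x → 𝟙 (Moved.isSource x) * f (Moved.sourceExc x))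
  split = begin
    excSum r (suc n) f
      ≡⟨ ∑-coloredPerms r (suc n) (f ∘ exc) ⟩
    ∑ (allVecs (suc n) (suc n)) (λ π → 𝟙 (distinct π) * ∑ (allVecs r (suc n)) (λ c → f (exc (π , c))))
      ≡⟨ ∑-allVecs-suc (suc n) n _ ⟩
    ∑ (allFin (suc n)) firstLetterSum
      ≡⟨ ∑-allFin-suc n firstLetterSum ⟩
    firstLetterSum Fin.zero + ∑ (allFin n) (firstLetterSum ∘ Fin.suc)
      ≡⟨ cong₂ _+_ (firstLetterSum≡ Fin.zero)
                   (trans (∑-cong (allFin n) (firstLetterSum≡ ∘ Fin.suc))
                          (sym (∑-cartesianProduct (allFin n) Fixed.sources _))) ⟩
    ∑ Fixed.sources (λ x → 𝟙 (Fixed.isSource x) * f (Fixed.sourceExc x))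
      + ∑ Moved.sources (λ x → 𝟙 (Moved.isSource x) * f (Moved.sourceExc x))
      ∎
    where open ≡-Reasoning

  insertionSum : Vec (Fin n) n → Vec (Fin r) n → ℤ
  insertionSum π c = ∑ (allFin r) (λ t → f (Fixed.targetExc (π , c , t)))
                   + ∑ (allFin r) (λ t → ∑ (allFin n) (λ p → f (Moved.targetExc (π , c , t , p))))

  collect : ∑ Fixed.targets (λ y → 𝟙 (Fixed.isTarget y) * f (Fixed.targetExc y))
          + ∑ Moved.targets (λ y → 𝟙 (Moved.isTarget y) * f (Moved.targetExc y))
          ≡ ∑ (allVecs n n) (λ π → 𝟙 (distinct π) * ∑ (allVecs r n) (insertionSum π))
  collect = begin
    ∑ Fixed.targets (λ y → 𝟙 (Fixed.isTarget y) * f (Fixed.targetExc y))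
      + ∑ Moved.targets (λ y → 𝟙 (Moved.isTarget y) * f (Moved.targetExc y))
      ≡⟨ cong₂ _+_ (∑-cartesianProduct-*ˡ (allVecs n n) _ (λ π → 𝟙 (distinct π)) _)
                   (∑-cartesianProduct-*ˡ (allVecs n n) _ (λ π → 𝟙 (distinct π)) _) ⟩
    ∑ (allVecs n n) (λ π → 𝟙 (distinct π) * fixedPart π) + ∑ (allVecs n n) (λ π → 𝟙 (distinct π) * movedPart π)
      ≡⟨ sym (∑-+ (allVecs n n) _ _) ⟩
    ∑ (allVecs n n) (λ π → 𝟙 (distinct π) * fixedPart π + 𝟙 (distinct π) * movedPart π)
      ≡⟨ ∑-cong (allVecs n n) (λ π → trans (sym (ℤₚ.*-distribˡ-+ (𝟙 (distinct π)) _ _))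
                                             (cong (𝟙 (distinct π) *_) (sym (parts π)))) ⟩
    ∑ (allVecs n n) (λ π → 𝟙 (distinct π) * ∑ (allVecs r n) (insertionSum π))
      ∎
    where
    open ≡-Reasoning
    fixedPart movedPart : Vec (Fin n) n → ℤ
    fixedPart π = ∑ (cartesianProduct (allVecs r n) (allFin r)) (λ ct → f (Fixed.targetExc (π , ct)))
    movedPart π = ∑ (cartesianProduct (allVecs r n) (cartesianProduct (allFin r) (allFin n)))
                    (λ ctp → f (Moved.targetExc (π , ctp)))
    parts : ∀ π → ∑ (allVecs r n) (insertionSum π) ≡ fixedPart π + movedPart π
    parts π = trans (∑-+ (allVecs r n) _ _) (cong₂ _+_
      (sym (∑-cartesianProduct (allVecs r n) (allFin r) _))
      (sym (trans (∑-cartesianProduct (allVecs r n) _ _)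
                  (∑-cong (allVecs r n) (λ c → ∑-cartesianProduct (allFin r) (allFin n) _)))))

  insertionSum≡excStep : ∀ π c → insertionSum π c ≡ excStep r n f (exc (π , c))
  insertionSum≡excStep π c = trans (cong₂ _+_ fixedColours movedColours)
                                   (lemma (+ r′) (+ e) (+ n) (f e) (f (suc e)))
    where
    e : ℕ
    e = exc (π , c)
    fixedColours : ∑ (allFin r) (λ t → f (Fixed.targetExc (π , c , t))) ≡ f e + + r′ * f (suc e)
    fixedColours = trans (∑-allFin-suc r′ (λ t → f (Fixed.targetExc (π , c , t))))
                         (cong (_+_ (f e)) (∑-allFin-const r′ (f (suc e))))
    movedColours : ∑ (allFin r) (λ t → ∑ (allFin n) (λ p → f (Moved.targetExc (π , c , t , p))))
                 ≡ + r * (+ e * f e + (+ n - + e) * f (suc e))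
    movedColours = trans (∑-cong (allFin r) (λ _ → trans (∑-cong (allFin n) (λ p → f-if (isExc π c p)))
                           (trans (∑-allFin-if n (isExc π c) (f e) (f (suc e)))
                                  (cong (λ k → + k * f e + (+ n - + k) * f (suc e)) (sym (exc≡count π c))))))
                         (∑-allFin-const r _)
      where
      f-if : ∀ b → f (if b then e else suc e) ≡ (if b then f e else f (suc e))
      f-if true  = refl
      f-if false = refl
    lemma : ∀ r′ e n fe fe′ → fe + r′ * fe′ + (+ 1 + r′) * (e * fe + (n - e) * fe′)
          ≡ (+ 1 + (+ 1 + r′) * e) * fe + ((+ 1 + r′) * (n - e) + (+ 1 + r′) - + 1) * fe′
    lemma = solve-∀

excSum-suc : ∀ r′ n f → excSum (suc r′) (suc n) f ≡ excSum (suc r′) n (excStep (suc r′) n f)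
excSum-suc r′ n f = begin
  excSum r (suc n) f
    ≡⟨ split ⟩
  ∑ Fixed.sources (λ x → 𝟙 (Fixed.isSource x) * f (Fixed.sourceExc x))
    + ∑ Moved.sources (λ x → 𝟙 (Moved.isSource x) * f (Moved.sourceExc x))
    ≡⟨ cong₂ _+_ (Fixed.∑-sources≡∑-targets f) (Moved.∑-sources≡∑-targets f) ⟩
  ∑ Fixed.targets (λ y → 𝟙 (Fixed.isTarget y) * f (Fixed.targetExc y))
    + ∑ Moved.targets (λ y → 𝟙 (Moved.isTarget y) * f (Moved.targetExc y))
    ≡⟨ collect ⟩
  ∑ (allVecs n n) (λ π → 𝟙 (distinct π) * ∑ (allVecs r n) (insertionSum π))
    ≡⟨ ∑-cong (allVecs n n) (λ π → cong (𝟙 (distinct π) *_) (∑-cong (allVecs r n) (insertionSum≡excStep π))) ⟩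
  ∑ (allVecs n n) (λ π → 𝟙 (distinct π) * ∑ (allVecs r n) (λ c → excStep r n f (exc (π , c))))
    ≡⟨ ∑-coloredPerms r n (excStep r n f ∘ exc) ⟨
  excSum r n (excStep r n f)
    ∎
  where
  open ≡-Reasoning
  open ExcRecurrence r′ n f

-- The bi-γ expansion

Σ≤-cong : ∀ n {h h′ : ℕ → ℤ} → (∀ k → h k ≡ h′ k) → Σ≤ n h ≡ Σ≤ n h′
Σ≤-cong zero    eq = eq 0
Σ≤-cong (suc n) eq = cong₂ _+_ (Σ≤-cong n eq) (eq (suc n))

Σ≤-+ : ∀ n (h h′ : ℕ → ℤ) → Σ≤ n (λ k → h k + h′ k) ≡ Σ≤ n h + Σ≤ n h′
Σ≤-+ zero    h h′ = refl
Σ≤-+ (suc n) h h′ = trans (cong (_+ (h (suc n) + h′ (suc n))) (Σ≤-+ n h h′))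
                          (interchange (Σ≤ n h) (Σ≤ n h′) (h (suc n)) (h′ (suc n)))
  where
  interchange : ∀ a b c d → a + b + (c + d) ≡ a + c + (b + d)
  interchange = solve-∀

Σ≤-*ˡ : ∀ n (c : ℤ) (h : ℕ → ℤ) → Σ≤ n (λ k → c * h k) ≡ c * Σ≤ n h
Σ≤-*ˡ zero    c h = refl
Σ≤-*ˡ (suc n) c h = trans (cong (_+ (c * h (suc n))) (Σ≤-*ˡ n c h)) (sym (ℤₚ.*-distribˡ-+ c _ _))

Σ≤-suc : ∀ n (h : ℕ → ℤ) → Σ≤ (suc n) h ≡ h 0 + Σ≤ n (h ∘ suc)
Σ≤-suc zero    h = refl
Σ≤-suc (suc n) h = trans (cong (_+ h (suc (suc n))) (Σ≤-suc n h)) (ℤₚ.+-assoc (h 0) _ _)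

Σ≤-truncate : ∀ {m n} (h : ℕ → ℤ) → m ℕ.≤ n → (∀ k → m ℕ.< k → h k ≡ + 0) → Σ≤ n h ≡ Σ≤ m h
Σ≤-truncate {m} {n} h m≤n vanish =
  trans (cong (λ i → Σ≤ i h) (sym (ℕₚ.m+[n∸m]≡n m≤n))) (drop (n ∸ m))
  where
  drop : ∀ d → Σ≤ (m ℕ.+ d) h ≡ Σ≤ m h
  drop zero    = cong (λ i → Σ≤ i h) (ℕₚ.+-identityʳ m)
  drop (suc d) rewrite ℕₚ.+-suc m d =
    trans (cong (_+_ (Σ≤ (m ℕ.+ d) h)) (vanish (suc (m ℕ.+ d)) (s≤s (ℕₚ.m≤m+n m d))))
          (trans (ℤₚ.+-identityʳ _) (drop d))

-- binomialSum m k f = Σ_j (m choose j) f (k + j): the functional of the polynomial x^k (1 + x)^m.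
binomialSum : ℕ → ℕ → (ℕ → ℤ) → ℤ
binomialSum zero    k f = f k
binomialSum (suc m) k f = binomialSum m k f + binomialSum m (suc k) f

binomialSum-pow : ∀ m k (x : ℤ) → binomialSum m k (x ^_) ≡ x ^ k * (+ 1 + x) ^ m
binomialSum-pow zero    k x = sym (ℤₚ.*-identityʳ (x ^ k))
binomialSum-pow (suc m) k x =
  trans (cong₂ _+_ (binomialSum-pow m k x) (binomialSum-pow m (suc k) x)) (lemma (x ^ k) ((+ 1 + x) ^ m) x)
  where
  lemma : ∀ xᵏ y x → xᵏ * y + (x * xᵏ) * y ≡ xᵏ * ((+ 1 + x) * y)
  lemma = solve-∀

binomialSum-excStep : ∀ r n m k (f : ℕ → ℤ) → binomialSum m k (excStep r n f) ≡
  (+ 1 + + r * + k) * binomialSum (suc m) k f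
  + (+ r * (+ n + + 1) - + 2 - + 2 * + r * + k - + r * + m) * binomialSum m (suc k) f
  + + 2 * + r * + m * binomialSum (m ∸ 1) (suc k) f
binomialSum-excStep r n zero k f = base (+ r) (+ n) (+ k) (f k) (f (suc k))
  where
  base : ∀ r n k f₀ f₁ → (+ 1 + r * k) * f₀ + (r * (n - k) + r - + 1) * f₁ ≡
         (+ 1 + r * k) * (f₀ + f₁) + (r * (n + + 1) - + 2 - + 2 * r * k - r * + 0) * f₁ + + 2 * r * + 0 * f₁
  base = solve-∀
binomialSum-excStep r n (suc zero) k f =
  trans (cong₂ _+_ (binomialSum-excStep r n zero k f) (binomialSum-excStep r n zero (suc k) f))
        (one (+ r) (+ n) (+ k) (f k) (f (suc k)) (f (suc (suc k))))
  where
  one : ∀ r n k f₀ f₁ f₂ →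
        ((+ 1 + r * k) * (f₀ + f₁) + (r * (n + + 1) - + 2 - + 2 * r * k - r * + 0) * f₁ + + 2 * r * + 0 * f₁)
        + ((+ 1 + r * (+ 1 + k)) * (f₁ + f₂) + (r * (n + + 1) - + 2 - + 2 * r * (+ 1 + k) - r * + 0) * f₂
           + + 2 * r * + 0 * f₂)
        ≡ (+ 1 + r * k) * ((f₀ + f₁) + (f₁ + f₂)) + (r * (n + + 1) - + 2 - + 2 * r * k - r * + 1) * (f₁ + f₂)
          + + 2 * r * + 1 * f₁
  one = solve-∀
binomialSum-excStep r n (suc (suc m)) k f =
  trans (cong₂ _+_ (binomialSum-excStep r n (suc m) k f) (binomialSum-excStep r n (suc m) (suc k) f))
        (step (+ r) (+ n) (+ k) (+ m) (binomialSum m k f) (binomialSum m (suc k) f)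
              (binomialSum m (suc (suc k)) f) (binomialSum m (suc (suc (suc k))) f))
  where
  step : ∀ r n k m b₀ b₁ b₂ b₃ →
         ((+ 1 + r * k) * ((b₀ + b₁) + (b₁ + b₂)) + (r * (n + + 1) - + 2 - + 2 * r * k - r * (+ 1 + m)) * (b₁ + b₂)
          + + 2 * r * (+ 1 + m) * b₁)
         + ((+ 1 + r * (+ 1 + k)) * ((b₁ + b₂) + (b₂ + b₃))
            + (r * (n + + 1) - + 2 - + 2 * r * (+ 1 + k) - r * (+ 1 + m)) * (b₂ + b₃) + + 2 * r * (+ 1 + m) * b₂)
         ≡ (+ 1 + r * k) * (((b₀ + b₁) + (b₁ + b₂)) + ((b₁ + b₂) + (b₂ + b₃)))
           + (r * (n + + 1) - + 2 - + 2 * r * k - r * (+ 1 + (+ 1 + m))) * ((b₁ + b₂) + (b₂ + b₃))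
           + + 2 * r * (+ 1 + (+ 1 + m)) * (b₁ + b₂)
  step = solve-∀

+m≡2k+[m∸2k] : ∀ {m} k → 2 ℕ.* k ℕ.≤ m → + m ≡ + 2 * + k + + (m ∸ 2 ℕ.* k)
+m≡2k+[m∸2k] {m} k 2k≤m =
  trans (cong +_ (sym (ℕₚ.m+[n∸m]≡n 2k≤m)))
        (trans (ℤₚ.pos-+ (2 ℕ.* k) (m ∸ 2 ℕ.* k)) (cong (_+ + (m ∸ 2 ℕ.* k)) (ℤₚ.pos-* 2 k)))

α⁺-coefficient : ∀ n k → 2 ℕ.* k ℕ.≤ suc n → + suc n - + 2 * + suc k + + 2 ≡ + (suc n ∸ 2 ℕ.* k)
α⁺-coefficient n k 2k≤1+n =
  trans (cong (λ z → z - + 2 * + suc k + + 2) (+m≡2k+[m∸2k] k 2k≤1+n)) (lemma (+ k) (+ (suc n ∸ 2 ℕ.* k)))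
  where
  lemma : ∀ k d → + 2 * k + d - + 2 * (+ 1 + k) + + 2 ≡ d
  lemma = solve-∀

α⁻-coefficient : ∀ n k → 2 ℕ.* k ℕ.≤ n → + suc n - + 2 * + suc k + + 1 ≡ + (n ∸ 2 ℕ.* k)
α⁻-coefficient n k 2k≤n =
  trans (cong (λ z → + 1 + z - + 2 * + suc k + + 1) (+m≡2k+[m∸2k] k 2k≤n)) (lemma (+ k) (+ (n ∸ 2 ℕ.* k)))
  where
  lemma : ∀ k d → + 1 + (+ 2 * k + d) - + 2 * (+ 1 + k) + + 1 ≡ d
  lemma = solve-∀

α⁺-vanishes : ∀ r n k → n ℕ.< 2 ℕ.* k → α⁺ r n k ≡ + 0
α⁻-vanishes : ∀ r n k → n ℕ.≤ 2 ℕ.* k → α⁻ r n k ≡ + 0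

α⁺-vanishes r zero          k       _ = refl
α⁺-vanishes r (suc zero)    (suc k) _ = refl
α⁺-vanishes r (suc (suc n)) (suc k) n+2<2[k+1] = begin
  c * α⁺ r (suc n) (suc k) + + 2 * + r * C * α⁺ r (suc n) k + + 2 * α⁻ r (suc n) k
    ≡⟨ cong₂ _+_ (cong₂ _+_ (cong (c *_)
                               (α⁺-vanishes r (suc n) (suc k) (ℕₚ.<-trans (ℕₚ.n<1+n _) n+2<2[k+1])))
                            (trans (ℤₚ.*-assoc (+ 2 * + r) C _) (cong (+ 2 * + r *_) C*α≡0)))
                 (cong (+ 2 *_) (α⁻-vanishes r (suc n) k n+1≤2k)) ⟩
  c * + 0 + + 2 * + r * + 0 + + 2 * + 0
    ≡⟨ zeros c (+ 2 * + r) ⟩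
  + 0 ∎
  where
  open ≡-Reasoning
  c C : ℤ
  c = + 1 + + r * + suc k
  C = + suc n - + 2 * + suc k + + 2
  n+1≤2k : suc n ℕ.≤ 2 ℕ.* k
  n+1≤2k = ℕₚ.≤-pred (ℕₚ.≤-pred (subst (suc (suc (suc n)) ℕ.≤_) (ℕₚ.*-suc 2 k) n+2<2[k+1]))
  C*α≡0 : C * α⁺ r (suc n) k ≡ + 0
  C*α≡0 with ℕₚ.m≤n⇒m<n∨m≡n n+1≤2k
  ... | inj₁ n+1<2k = trans (cong (C *_) (α⁺-vanishes r (suc n) k n+1<2k)) (ℤₚ.*-zeroʳ C)
  ... | inj₂ n+1≡2k = trans (cong (_* α⁺ r (suc n) k) C≡0) (ℤₚ.*-zeroˡ (α⁺ r (suc n) k))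
    where
    C≡0 : C ≡ + 0
    C≡0 = trans (α⁺-coefficient n k (ℕₚ.≤-reflexive (sym n+1≡2k)))
                (cong +_ (trans (cong (_∸ 2 ℕ.* k) n+1≡2k) (ℕₚ.n∸n≡0 (2 ℕ.* k))))
  zeros : ∀ a b → a * + 0 + b * + 0 + + 2 * + 0 ≡ + 0
  zeros = solve-∀

α⁻-vanishes r zero          k       _ = refl
α⁻-vanishes r (suc zero)    (suc k) _ = refl
α⁻-vanishes r (suc (suc n)) (suc k) n+2≤2[k+1] = begin
  (+ r - + 2) * α⁺ r (suc n) (suc k) + c * α⁻ r (suc n) (suc k) + + 2 * + r * C * α⁻ r (suc n) k
    ≡⟨ cong₂ _+_ (cong₂ _+_ (cong ((+ r - + 2) *_)
                               (α⁺-vanishes r (suc n) (suc k) (ℕₚ.<-≤-trans (ℕₚ.n<1+n _) n+2≤2[k+1])))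
                            (cong (c *_)
                               (α⁻-vanishes r (suc n) (suc k) (ℕₚ.≤-trans (ℕₚ.n≤1+n _) n+2≤2[k+1]))))
                 (trans (ℤₚ.*-assoc (+ 2 * + r) C _) (cong (+ 2 * + r *_) C*α≡0)) ⟩
  (+ r - + 2) * + 0 + c * + 0 + + 2 * + r * + 0
    ≡⟨ zeros (+ r - + 2) c (+ 2 * + r) ⟩
  + 0 ∎
  where
  open ≡-Reasoning
  c C : ℤ
  c = + r - + 1 + + r * + suc k
  C = + suc n - + 2 * + suc k + + 1
  n≤2k : n ℕ.≤ 2 ℕ.* k
  n≤2k = ℕₚ.≤-pred (ℕₚ.≤-pred (subst (suc (suc n) ℕ.≤_) (ℕₚ.*-suc 2 k) n+2≤2[k+1]))
  C*α≡0 : C * α⁻ r (suc n) k ≡ + 0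
  C*α≡0 with ℕₚ.m≤n⇒m<n∨m≡n n≤2k
  ... | inj₁ n<2k = trans (cong (C *_) (α⁻-vanishes r (suc n) k n<2k)) (ℤₚ.*-zeroʳ C)
  ... | inj₂ n≡2k = trans (cong (_* α⁻ r (suc n) k) C≡0) (ℤₚ.*-zeroˡ (α⁻ r (suc n) k))
    where
    C≡0 : C ≡ + 0
    C≡0 = trans (α⁻-coefficient n k (ℕₚ.≤-reflexive (sym n≡2k)))
                (cong +_ (trans (cong (_∸ 2 ℕ.* k) n≡2k) (ℕₚ.n∸n≡0 (2 ℕ.* k))))
  zeros : ∀ a b d → a * + 0 + b * + 0 + d * + 0 ≡ + 0
  zeros = solve-∀

0≤+ : ∀ m → + 0 ≤ℤ + m
0≤+ m = +≤+ z≤n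

0≤-+ : ∀ {a b} → + 0 ≤ℤ a → + 0 ≤ℤ b → + 0 ≤ℤ a + b
0≤-+ = ℤₚ.+-mono-≤

0≤-* : ∀ {a b} → + 0 ≤ℤ a → + 0 ≤ℤ b → + 0 ≤ℤ a * b
0≤-* {a} {b} 0≤a 0≤b = subst₂ (λ u v → + 0 ≤ℤ u * v) (ℤₚ.0≤i⇒+∣i∣≡i 0≤a) (ℤₚ.0≤i⇒+∣i∣≡i 0≤b)
  (subst (+ 0 ≤ℤ_) (ℤₚ.pos-* ∣ a ∣ ∣ b ∣) (0≤+ _))

0≤+*+ : ∀ m n → + 0 ≤ℤ + m * + n
0≤+*+ m n = 0≤-* (0≤+ m) (0≤+ n)

0≤-*0 : ∀ C {a} → a ≡ + 0 → + 0 ≤ℤ C * a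
0≤-*0 C refl = subst (+ 0 ≤ℤ_) (sym (ℤₚ.*-zeroʳ C)) (0≤+ 0)

0≤C⁺*α⁺ : ∀ r n k → + 0 ≤ℤ α⁺ r (suc n) k → + 0 ≤ℤ (+ suc n - + 2 * + suc k + + 2) * α⁺ r (suc n) k
0≤C⁺*α⁺ r n k 0≤α with 2 ℕ.* k ℕ.≤? suc n
... | yes 2k≤n+1 = 0≤-* (subst (+ 0 ≤ℤ_) (sym (α⁺-coefficient n k 2k≤n+1)) (0≤+ _)) 0≤α
... | no  2k≰n+1 = 0≤-*0 (+ suc n - + 2 * + suc k + + 2) (α⁺-vanishes r (suc n) k (ℕₚ.≰⇒> 2k≰n+1))

0≤C⁻*α⁻ : ∀ r n k → + 0 ≤ℤ α⁻ r (suc n) k → + 0 ≤ℤ (+ suc n - + 2 * + suc k + + 1) * α⁻ r (suc n) k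
0≤C⁻*α⁻ r n k 0≤α with 2 ℕ.* k ℕ.≤? n
... | yes 2k≤n = 0≤-* (subst (+ 0 ≤ℤ_) (sym (α⁻-coefficient n k 2k≤n)) (0≤+ _)) 0≤α
... | no  2k≰n = 0≤-*0 (+ suc n - + 2 * + suc k + + 1) (α⁻-vanishes r (suc n) k (ℕₚ.≰⇒> 2k≰n))

α⁺-nonneg : ∀ r n k → + 0 ≤ℤ α⁺ (2 ℕ.+ r) n k
α⁻-nonneg : ∀ r n k → + 0 ≤ℤ α⁻ (2 ℕ.+ r) n k

α⁺-nonneg r zero          k       = 0≤+ 0
α⁺-nonneg r (suc zero)    zero    = 0≤+ 1
α⁺-nonneg r (suc zero)    (suc k) = 0≤+ 0
α⁺-nonneg r (suc (suc n)) zero    = 0≤-* (0≤-+ (0≤+ 1) (0≤+*+ (2 ℕ.+ r) 0)) (α⁺-nonneg r (suc n) zero)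
α⁺-nonneg r (suc (suc n)) (suc k) =
  0≤-+ (0≤-+ (0≤-* (0≤-+ (0≤+ 1) (0≤+*+ (2 ℕ.+ r) (suc k))) (α⁺-nonneg r (suc n) (suc k)))
             (subst (+ 0 ≤ℤ_) (sym (ℤₚ.*-assoc (+ 2 * + (2 ℕ.+ r)) (+ suc n - + 2 * + suc k + + 2)
                                               (α⁺ (2 ℕ.+ r) (suc n) k)))
                    (0≤-* (0≤+*+ 2 (2 ℕ.+ r)) (0≤C⁺*α⁺ (2 ℕ.+ r) n k (α⁺-nonneg r (suc n) k)))))
       (0≤-* (0≤+ 2) (α⁻-nonneg r (suc n) k))

α⁻-nonneg r zero          k       = 0≤+ 0
α⁻-nonneg r (suc zero)    zero    = 0≤+ r
α⁻-nonneg r (suc zero)    (suc k) = 0≤+ 0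
α⁻-nonneg r (suc (suc n)) zero    =
  0≤-+ (0≤-* (0≤+ r) (α⁺-nonneg r (suc n) zero))
       (0≤-* (0≤-+ (0≤+ (suc r)) (0≤+*+ (2 ℕ.+ r) 0)) (α⁻-nonneg r (suc n) zero))
α⁻-nonneg r (suc (suc n)) (suc k) =
  0≤-+ (0≤-+ (0≤-* (0≤+ r) (α⁺-nonneg r (suc n) (suc k)))
             (0≤-* (0≤-+ (0≤+ (suc r)) (0≤+*+ (2 ℕ.+ r) (suc k))) (α⁻-nonneg r (suc n) (suc k))))
       (subst (+ 0 ≤ℤ_) (sym (ℤₚ.*-assoc (+ 2 * + (2 ℕ.+ r)) (+ suc n - + 2 * + suc k + + 1)
                                         (α⁻ (2 ℕ.+ r) (suc n) k)))
              (0≤-* (0≤+*+ 2 (2 ℕ.+ r)) (0≤C⁻*α⁻ (2 ℕ.+ r) n k (α⁻-nonneg r (suc n) k))))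

biGammaF : ℕ → ℕ → (ℕ → ℤ) → ℤ
biGammaF r n f = Σ≤ n (λ k → α⁺ r n k * binomialSum (n ∸ 2 ℕ.* k) k f)
               + Σ≤ n (λ k → α⁻ r n k * binomialSum (n ∸ 1 ∸ 2 ℕ.* k) (suc k) f)

module BiGammaStep (r : ℕ) (f : ℕ → ℤ) where

  -- The k-th term of biGammaF r N (excStep r N f), for coefficients a = α⁺ r N k and b = α⁻ r N k.
  stepped : ℕ → ℤ → ℤ → ℕ → ℤ
  stepped N a b k = a * binomialSum (N ∸ 2 ℕ.* k) k (excStep r N f)
                  + b * binomialSum (N ∸ 1 ∸ 2 ℕ.* k) (suc k) (excStep r N f)

  -- It splits into a part in the k-th γ-basis elements of order N + 1 and a part in the (k + 1)-st,
  -- whose coefficients are the summands of the recursion for α⁺ r (N + 1) and α⁻ r (N + 1).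
  kept raised : ℕ → ℤ → ℤ → ℕ → ℤ
  kept N a b k = (+ 1 + + r * + k) * a * binomialSum (suc N ∸ 2 ℕ.* k) k f
               + ((+ r - + 2) * a + (+ r - + 1 + + r * + k) * b) * binomialSum (N ∸ 2 ℕ.* k) (suc k) f
  raised N a b k = (+ 2 * + r * (+ N - + 2 * + suc k + + 2) * a + + 2 * b) * binomialSum (suc N ∸ 2 ℕ.* suc k) (suc k) f
                 + + 2 * + r * (+ N - + 2 * + suc k + + 1) * b * binomialSum (N ∸ 2 ℕ.* suc k) (suc (suc k)) f

  -- For N = 1 + 2k + m every truncated subtraction evaluates, and the rest is a ring identity.
  stepped-interior : ∀ k m a b → let N = suc (2 ℕ.* k ℕ.+ m) in
                     stepped N a b k ≡ kept N a b k + raised N a b k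
  stepped-interior k m a b =
    trans (cong₂ (λ i j → a * binomialSum i k (excStep r N f) + b * binomialSum j (suc k) (excStep r N f))
                 (cancel 1 (2 ℕ.* k) m) (cancel 0 (2 ℕ.* k) m))
    (trans (cong₂ (λ x y → a * x + b * y) (binomialSum-excStep r N (suc m) k f) (binomialSum-excStep r N m (suc k) f))
    (trans (regroup (+ r) (+ N) (+ k) (+ m) a b (binomialSum (suc (suc m)) k f) (binomialSum m (suc k) f)
                    (binomialSum m (suc (suc k)) f) (binomialSum (m ∸ 1) (suc (suc k)) f) +N≡1+2k+m)
    (sym (cong₂ _+_
      (cong₂ (λ i j → (+ 1 + + r * + k) * a * binomialSum i k f
                      + ((+ r - + 2) * a + (+ r - + 1 + + r * + k) * b) * binomialSum j (suc k) f)
             (cancel 2 (2 ℕ.* k) m) (cancel 1 (2 ℕ.* k) m))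
      (cong₂ (λ i j → (+ 2 * + r * (+ N - + 2 * + suc k + + 2) * a + + 2 * b) * binomialSum i (suc k) f
                      + + 2 * + r * (+ N - + 2 * + suc k + + 1) * b * binomialSum j (suc (suc k)) f)
             (trans (cong (suc N ∸_) (ℕₚ.*-suc 2 k)) (cancel 0 (2 ℕ.* k) m))
             (trans (cong (N ∸_) (ℕₚ.*-suc 2 k)) (cancel′ (2 ℕ.* k) m)))))))
    where
    N : ℕ
    N = suc (2 ℕ.* k ℕ.+ m)
    cancel : ∀ j a m → j ℕ.+ (a ℕ.+ m) ∸ a ≡ j ℕ.+ m
    cancel j zero    m = refl
    cancel j (suc a) m = trans (cong (_∸ suc a) (ℕₚ.+-suc j (a ℕ.+ m))) (cancel j a m)
    cancel′ : ∀ a m → a ℕ.+ m ∸ suc a ≡ m ∸ 1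
    cancel′ zero    m = refl
    cancel′ (suc a) m = cancel′ a m
    +N≡1+2k+m : + N ≡ + 1 + (+ 2 * + k + + m)
    +N≡1+2k+m = cong (_+_ (+ 1)) (trans (ℤₚ.pos-+ (2 ℕ.* k) m) (cong (_+ + m) (ℤₚ.pos-* 2 k)))
    regroup : ∀ r N k m a b B₀ p q z → N ≡ + 1 + (+ 2 * k + m) →
       a * ((+ 1 + r * k) * B₀ + (r * (N + + 1) - + 2 - + 2 * r * k - r * (+ 1 + m)) * (p + q) + + 2 * r * (+ 1 + m) * p)
       + b * ((+ 1 + r * (+ 1 + k)) * (p + q) + (r * (N + + 1) - + 2 - + 2 * r * (+ 1 + k) - r * m) * q + + 2 * r * m * z)
       ≡ ((+ 1 + r * k) * a * B₀ + ((r - + 2) * a + (r - + 1 + r * k) * b) * (p + q))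
         + ((+ 2 * r * (N - + 2 * (+ 1 + k) + + 2) * a + + 2 * b) * p + + 2 * r * (N - + 2 * (+ 1 + k) + + 1) * b * z)
    regroup r _ k m a b B₀ p q z refl = ring r k m a b B₀ p q z
      where
      ring : ∀ r k m a b B₀ p q z →
        a * ((+ 1 + r * k) * B₀ + (r * ((+ 1 + (+ 2 * k + m)) + + 1) - + 2 - + 2 * r * k - r * (+ 1 + m)) * (p + q)
             + + 2 * r * (+ 1 + m) * p)
        + b * ((+ 1 + r * (+ 1 + k)) * (p + q) + (r * ((+ 1 + (+ 2 * k + m)) + + 1) - + 2 - + 2 * r * (+ 1 + k) - r * m) * q
               + + 2 * r * m * z)
        ≡ ((+ 1 + r * k) * a * B₀ + ((r - + 2) * a + (r - + 1 + r * k) * b) * (p + q))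
          + ((+ 2 * r * ((+ 1 + (+ 2 * k + m)) - + 2 * (+ 1 + k) + + 2) * a + + 2 * b) * p
             + + 2 * r * ((+ 1 + (+ 2 * k + m)) - + 2 * (+ 1 + k) + + 1) * b * z)
      ring = solve-∀

  stepped-boundary : ∀ k a → let N = 2 ℕ.* k in
                     stepped N a (+ 0) k ≡ kept N a (+ 0) k + raised N a (+ 0) k
  stepped-boundary k a =
    trans (cong (λ i → a * binomialSum i k (excStep r N f) + + 0 * u) (ℕₚ.n∸n≡0 N))
    (trans (cong (λ x → a * x + + 0 * u) (binomialSum-excStep r N 0 k f))
    (trans (regroup (+ r) (+ N) (+ k) a (binomialSum 1 k f) (binomialSum 0 (suc k) f) u w z (ℤₚ.pos-* 2 k))
    (sym (cong (_+ raised N a (+ 0) k)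
      (cong₂ (λ i j → (+ 1 + + r * + k) * a * binomialSum i k f
                      + ((+ r - + 2) * a + (+ r - + 1 + + r * + k) * + 0) * binomialSum j (suc k) f)
             (ℕₚ.m+n∸n≡m 1 N) (ℕₚ.n∸n≡0 N))))))
    where
    N : ℕ
    N = 2 ℕ.* k
    u w z : ℤ
    u = binomialSum (N ∸ 1 ∸ 2 ℕ.* k) (suc k) (excStep r N f)
    w = binomialSum (suc N ∸ 2 ℕ.* suc k) (suc k) f
    z = binomialSum (N ∸ 2 ℕ.* suc k) (suc (suc k)) f
    regroup : ∀ r N k a B₁ p u w z → N ≡ + 2 * k →
      a * ((+ 1 + r * k) * B₁ + (r * (N + + 1) - + 2 - + 2 * r * k - r * + 0) * p + + 2 * r * + 0 * p) + + 0 * u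
      ≡ ((+ 1 + r * k) * a * B₁ + ((r - + 2) * a + (r - + 1 + r * k) * + 0) * p)
        + ((+ 2 * r * (N - + 2 * (+ 1 + k) + + 2) * a + + 2 * + 0) * w + + 2 * r * (N - + 2 * (+ 1 + k) + + 1) * + 0 * z)
    regroup r _ k a B₁ p u w z refl = ring r k a B₁ p u w z
      where
      ring : ∀ r k a B₁ p u w z →
        a * ((+ 1 + r * k) * B₁ + (r * ((+ 2 * k) + + 1) - + 2 - + 2 * r * k - r * + 0) * p + + 2 * r * + 0 * p) + + 0 * u
        ≡ ((+ 1 + r * k) * a * B₁ + ((r - + 2) * a + (r - + 1 + r * k) * + 0) * p)
          + ((+ 2 * r * ((+ 2 * k) - + 2 * (+ 1 + k) + + 2) * a + + 2 * + 0) * w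
             + + 2 * r * ((+ 2 * k) - + 2 * (+ 1 + k) + + 1) * + 0 * z)
      ring = solve-∀

  stepped-exterior : ∀ N k → stepped N (+ 0) (+ 0) k ≡ kept N (+ 0) (+ 0) k + raised N (+ 0) (+ 0) k
  stepped-exterior N k = ring (+ 1 + + r * + k) (+ r - + 2) (+ r - + 1 + + r * + k)
    (+ 2 * + r * (+ N - + 2 * + suc k + + 2)) (+ 2 * + r * (+ N - + 2 * + suc k + + 1))
    (binomialSum (N ∸ 2 ℕ.* k) k (excStep r N f)) (binomialSum (N ∸ 1 ∸ 2 ℕ.* k) (suc k) (excStep r N f))
    (binomialSum (suc N ∸ 2 ℕ.* k) k f) (binomialSum (N ∸ 2 ℕ.* k) (suc k) f)
    (binomialSum (suc N ∸ 2 ℕ.* suc k) (suc k) f) (binomialSum (N ∸ 2 ℕ.* suc k) (suc (suc k)) f)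
    where
    ring : ∀ c₁ c₂ c₃ c₄ c₅ x y u v w z →
      + 0 * x + + 0 * y ≡ (c₁ * + 0 * u + (c₂ * + 0 + c₃ * + 0) * v) + ((c₄ * + 0 + + 2 * + 0) * w + c₅ * + 0 * z)
    ring = solve-∀

  stepped≡kept+raised : ∀ N k → let a = α⁺ r N k; b = α⁻ r N k in
                        stepped N a b k ≡ kept N a b k + raised N a b k
  stepped≡kept+raised N k with ℕₚ.<-cmp (2 ℕ.* k) N
  ... | tri< 2k<N _ _ = subst Splits (ℕₚ.m+[n∸m]≡n 2k<N) (stepped-interior k (N ∸ suc (2 ℕ.* k)) _ _)
    where
    Splits : ℕ → Set
    Splits N = stepped N (α⁺ r N k) (α⁻ r N k) k ≡ kept N (α⁺ r N k) (α⁻ r N k) k + raised N (α⁺ r N k) (α⁻ r N k) k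
  ... | tri≈ _ 2k≡N _ rewrite sym 2k≡N | α⁻-vanishes r (2 ℕ.* k) k ℕₚ.≤-refl = stepped-boundary k _
  ... | tri> _ _ N<2k rewrite α⁻-vanishes r N k (ℕₚ.<⇒≤ N<2k) | α⁺-vanishes r N k N<2k = stepped-exterior N k

  module _ (n : ℕ) where

    N : ℕ
    N = suc n

    keptAt raisedAt termAt : ℕ → ℤ
    keptAt k = kept N (α⁺ r N k) (α⁻ r N k) k
    raisedAt zero    = + 0
    raisedAt (suc k) = raised N (α⁺ r N k) (α⁻ r N k) k
    termAt k = α⁺ r (suc N) k * binomialSum (suc N ∸ 2 ℕ.* k) k f
             + α⁻ r (suc N) k * binomialSum (suc N ∸ 1 ∸ 2 ℕ.* k) (suc k) f

    termAt≡kept+raised : ∀ k → termAt k ≡ keptAt k + raisedAt k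
    termAt≡kept+raised zero    = sym (ℤₚ.+-identityʳ _)
    termAt≡kept+raised (suc k) = ring (+ r) (+ 1 + + r * + suc k) (+ r - + 1 + + r * + suc k)
      (+ N - + 2 * + suc k + + 2) (+ N - + 2 * + suc k + + 1) (α⁺ r N (suc k)) (α⁻ r N (suc k)) (α⁺ r N k) (α⁻ r N k)
      (binomialSum (suc N ∸ 2 ℕ.* suc k) (suc k) f) (binomialSum (N ∸ 2 ℕ.* suc k) (suc (suc k)) f)
      where
      ring : ∀ r c d C⁺ C⁻ a₁ b₁ a₀ b₀ u v →
             (c * a₁ + + 2 * r * C⁺ * a₀ + + 2 * b₀) * u + ((r - + 2) * a₁ + d * b₁ + + 2 * r * C⁻ * b₀) * v
             ≡ (c * a₁ * u + ((r - + 2) * a₁ + d * b₁) * v) + ((+ 2 * r * C⁺ * a₀ + + 2 * b₀) * u + + 2 * r * C⁻ * b₀ * v)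
      ring = solve-∀

    keptAt-top : keptAt (suc N) ≡ + 0
    keptAt-top
      rewrite α⁺-vanishes r N (suc N) (ℕₚ.m≤n*m (suc N) 2)
            | α⁻-vanishes r N (suc N) (ℕₚ.≤-trans (ℕₚ.n≤1+n N) (ℕₚ.m≤n*m (suc N) 2)) =
      ring (+ 1 + + r * + suc N) (+ r - + 2) (+ r - + 1 + + r * + suc N)
           (binomialSum (suc N ∸ 2 ℕ.* suc N) (suc N) f) (binomialSum (N ∸ 2 ℕ.* suc N) (suc (suc N)) f)
      where
      ring : ∀ a b c u v → a * + 0 * u + (b * + 0 + c * + 0) * v ≡ + 0
      ring = solve-∀

    biGammaF-excStep : biGammaF r N (excStep r N f) ≡ biGammaF r (suc N) f
    biGammaF-excStep = begin
      biGammaF r N (excStep r N f)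
        ≡⟨ Σ≤-+ N _ _ ⟨
      Σ≤ N (λ k → stepped N (α⁺ r N k) (α⁻ r N k) k)
        ≡⟨ Σ≤-cong N (stepped≡kept+raised N) ⟩
      Σ≤ N (λ k → keptAt k + raisedAt (suc k))
        ≡⟨ Σ≤-+ N keptAt (raisedAt ∘ suc) ⟩
      Σ≤ N keptAt + Σ≤ N (raisedAt ∘ suc)
        ≡⟨ cong₂ _+_ (sym (trans (cong (_+_ (Σ≤ N keptAt)) keptAt-top) (ℤₚ.+-identityʳ (Σ≤ N keptAt))))
                     (sym (ℤₚ.+-identityˡ (Σ≤ N (raisedAt ∘ suc)))) ⟩
      Σ≤ (suc N) keptAt + (raisedAt 0 + Σ≤ N (raisedAt ∘ suc))
        ≡⟨ cong (_+_ (Σ≤ (suc N) keptAt)) (Σ≤-suc N raisedAt) ⟨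
      Σ≤ (suc N) keptAt + Σ≤ (suc N) raisedAt
        ≡⟨ Σ≤-+ (suc N) keptAt raisedAt ⟨
      Σ≤ (suc N) (λ k → keptAt k + raisedAt k)
        ≡⟨ Σ≤-cong (suc N) termAt≡kept+raised ⟨
      Σ≤ (suc N) termAt
        ≡⟨ Σ≤-+ (suc N) _ _ ⟩
      biGammaF r (suc N) f
        ∎
      where open ≡-Reasoning

excSum≡biGammaF : ∀ r′ n (f : ℕ → ℤ) → excSum (suc r′) (suc n) f ≡ biGammaF (suc r′) (suc n) f
excSum≡biGammaF r′ zero    f = trans (excSum-suc r′ 0 f) (ring (+ suc r′) (f 0) (f 1) (f 2))
  where
  ring : ∀ r f₀ f₁ f₂ → ((+ 1 + r * + 0) * f₀ + (r * (+ 0 - + 0) + r - + 1) * f₁) + + 0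
         ≡ (+ 1 * (f₀ + f₁) + + 0 * f₁) + ((r - + 2) * f₁ + + 0 * f₂)
  ring = solve-∀
excSum≡biGammaF r′ (suc n) f =
  trans (excSum-suc r′ (suc n) f)
        (trans (excSum≡biGammaF r′ n (excStep (suc r′) (suc n) f))
               (BiGammaStep.biGammaF-excStep (suc r′) f n))

⌊n/2⌋<k⇒n<2k : ∀ n k → ⌊ n /2⌋ ℕ.< k → n ℕ.< 2 ℕ.* k
⌊n/2⌋<k⇒n<2k zero          (suc k) _ = s≤s z≤n
⌊n/2⌋<k⇒n<2k (suc zero)    (suc k) _ = subst (2 ℕ.≤_) (sym (ℕₚ.*-suc 2 k)) (s≤s (s≤s z≤n))
⌊n/2⌋<k⇒n<2k (suc (suc n)) (suc k) (s≤s ⌊n/2⌋<k) =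
  subst (suc (suc (suc n)) ℕ.≤_) (sym (ℕₚ.*-suc 2 k)) (s≤s (s≤s (⌊n/2⌋<k⇒n<2k n k ⌊n/2⌋<k)))

biGammaF-pow : ∀ r n (x : ℤ) → biGammaF r n (x ^_) ≡ biGamma r n x
biGammaF-pow r n x = cong₂ _+_ plus minus
  where
  plus : Σ≤ n (λ k → α⁺ r n k * binomialSum (n ∸ 2 ℕ.* k) k (x ^_))
       ≡ Σ≤ ⌊ n /2⌋ (λ k → α⁺ r n k * x ^ k * (+ 1 + x) ^ (n ∸ 2 ℕ.* k))
  plus = trans (Σ≤-cong n (λ k → trans (cong (α⁺ r n k *_) (binomialSum-pow (n ∸ 2 ℕ.* k) k x))
                                       (sym (ℤₚ.*-assoc (α⁺ r n k) _ _))))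
               (Σ≤-truncate _ (ℕₚ.⌊n/2⌋≤n n) (λ k ⌊n/2⌋<k →
                 cong (λ a → a * x ^ k * (+ 1 + x) ^ (n ∸ 2 ℕ.* k)) (α⁺-vanishes r n k (⌊n/2⌋<k⇒n<2k n k ⌊n/2⌋<k))))
  minus : Σ≤ n (λ k → α⁻ r n k * binomialSum (n ∸ 1 ∸ 2 ℕ.* k) (suc k) (x ^_))
        ≡ x * Σ≤ ⌊ (n ∸ 1) /2⌋ (λ k → α⁻ r n k * x ^ k * (+ 1 + x) ^ (n ∸ 1 ∸ 2 ℕ.* k))
  minus = trans (Σ≤-cong n (λ k → trans (cong (α⁻ r n k *_) (binomialSum-pow (n ∸ 1 ∸ 2 ℕ.* k) (suc k) x))
                                        (factor (α⁻ r n k) x (x ^ k) ((+ 1 + x) ^ (n ∸ 1 ∸ 2 ℕ.* k)))))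
          (trans (Σ≤-*ˡ n x _)
                 (cong (x *_) (Σ≤-truncate _ (ℕₚ.≤-trans (ℕₚ.⌊n/2⌋≤n (n ∸ 1)) (ℕₚ.m∸n≤m n 1))
                   (λ k ⌊[n-1]/2⌋<k → cong (λ a → a * x ^ k * (+ 1 + x) ^ (n ∸ 1 ∸ 2 ℕ.* k))
                                            (α⁻-vanishes r n k (n≤2k n k ⌊[n-1]/2⌋<k))))))
    where
    factor : ∀ a x xᵏ y → a * ((x * xᵏ) * y) ≡ x * (a * xᵏ * y)
    factor = solve-∀
    n≤2k : ∀ n k → ⌊ (n ∸ 1) /2⌋ ℕ.< k → n ℕ.≤ 2 ℕ.* k
    n≤2k zero    k _ = z≤n
    n≤2k (suc n) k lt = ⌊n/2⌋<k⇒n<2k n k lt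

theorem40 : (r : ℕ) → 2 ≤ r → (n : ℕ) → 1 ≤ n →
    ((k : ℕ) → + 0 ≤ℤ α⁺ r n k) × ((k : ℕ) → + 0 ≤ℤ α⁻ r n k)
    × ((x : ℤ) → A n r x ≡ biGamma r n x)
theorem40 (suc (suc r)) (s≤s (s≤s z≤n)) (suc n) (s≤s z≤n) =
  α⁺-nonneg r (suc n) , α⁻-nonneg r (suc n) ,
  λ x → trans (excSum≡biGammaF (suc r) n (x ^_)) (biGammaF-pow (suc (suc r)) (suc n) x)
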